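{- Fix an integer $s\ge0$. For $k\ge1$ let $t^{(s)}_k(p,q)=q$ if $k\le s$ and $t^{(s)}_k(p,q)=p$ if $k>s$. Define polynomials $c^{(s)}_{n,k}(p,q)$ by $c^{(s)}_{0,0}=1$, $c^{(s)}_{n,k}=0$ unless $0\le k\le n$, and for all $n\ge0$: $c^{(s)}_{n+1,0}=(1+p+q)c^{(s)}_{n,0}+t^{(s)}_1(p,q)c^{(s)}_{n,1}$ and $c^{(s)}_{n+1,k}=c^{(s)}_{n,k-1}+(1+p+q)c^{(s)}_{n,k}+t^{(s)}_{k+1}(p,q)c^{(s)}_{n,k+1}$ for $k\ge1$. Then $(c^{(s)}_{n,0}(p,q))_{n\ge0}$ is a Stieltjes moment sequence of polynomials.
   Context: A sequence $(a_k(p,q))_{k\ge0}$ of polynomials is a Stieltjes moment sequence of polynomials if every minor of every finite order of the Hankel matrix $[a_{i+j}(p,q)]_{i,j\ge0}$ is a polynomial in $p,q$ with nonnegative coefficients. -}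

module Defs where

open import Data.Nat as ℕ using (ℕ; zero; suc)
open import Data.Integer as ℤ using (ℤ; +_; -[1+_])
open import Data.Product using (_×_; _,_)
open import Data.List using (List; []; _∷_; _++_; concatMap; map)
open import Data.Fin as Fin using (Fin; zero; suc; punchIn; toℕ)
open import Data.Bool using (if_then_else_)
open import Relation.Nullary.Decidable using (⌊_⌋)

-- Polynomials in two commuting variables p, q with integer coefficients,
-- represented as formal finite sums of monomials  c · p^i · q^j
-- (a list of triples (c , i , j)).  Equal polynomials may have several
-- representations; only the coefficient function `coeff` matters.
Poly : Set
Poly = List (ℤ × ℕ × ℕ)

const : ℤ → Poly
const c = (c , 0 , 0) ∷ []

0P 1P pP qP : Poly
0P = []
1P = const (+ 1)
pP = (+ 1 , 1 , 0) ∷ []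
qP = (+ 1 , 0 , 1) ∷ []

infixl 6 _+P_
infixl 7 _*P_

_+P_ : Poly → Poly → Poly
f +P g = f ++ g

_*P_ : Poly → Poly → Poly
f *P g = concatMap (λ { (a , i , j) → map (λ { (b , k , l) → (a ℤ.* b , i ℕ.+ k , j ℕ.+ l) }) g }) f

coeff : Poly → ℕ → ℕ → ℤ
coeff [] i j = + 0
coeff ((c , k , l) ∷ f) i j =
  (if ⌊ k ℕ.≟ i ⌋ then (if ⌊ l ℕ.≟ j ⌋ then c else + 0) else + 0) ℤ.+ coeff f i j

NonnegCoeffs : Poly → Set
NonnegCoeffs f = ∀ i j → + 0 ℤ.≤ coeff f i j

sumFin : ∀ n → (Fin n → Poly) → Poly
sumFin zero f = 0P
sumFin (suc n) f = f zero +P sumFin n (λ k → f (suc k))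

sign : ℕ → Poly
sign zero = 1P
sign (suc zero) = const -[1+ 0 ]
sign (suc (suc k)) = sign k

det : ∀ n → (Fin n → Fin n → Poly) → Poly
det zero M = 1P
det (suc n) M =
  sumFin (suc n) (λ j → sign (toℕ j) *P M zero j *P det n (λ a b → M (suc a) (punchIn j b)))

StrictlyIncreasing : ∀ {r} → (Fin r → ℕ) → Set
StrictlyIncreasing {r} σ = ∀ (a b : Fin r) → a Fin.< b → σ a ℕ.< σ b

StieltjesMomentSeq : (ℕ → Poly) → Set
StieltjesMomentSeq a =
  ∀ (r : ℕ) (rows cols : Fin r → ℕ) →
  StrictlyIncreasing rows → StrictlyIncreasing cols →
  NonnegCoeffs (det r (λ x y → a (rows x ℕ.+ cols y)))

t : ℕ → ℕ → Poly
t s k = if ⌊ k ℕ.≤? s ⌋ then qP else pP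

c : ℕ → ℕ → ℕ → Poly
c s zero zero = 1P
c s zero (suc k) = 0P
c s (suc n) zero = (1P +P pP +P qP) *P c s n 0 +P t s 1 *P c s n 1
c s (suc n) (suc k) =
  c s n k +P (1P +P pP +P qP) *P c s n (suc k) +P t s (suc (suc k)) *P c s n (suc (suc k))

module Submission where

-- Write C for the array (c s n k).  The recurrence says that, restricted to finitely many rows, C is
-- the identity multiplied on the right by shifted copies of the tridiagonal production matrix, which
-- has 1 above, 1 + p + q on and t (k + 1) below the diagonal.  The Hankel matrix of (c s n 0) is
-- C · diag(t 1 ⋯ t k) · Cᵀ, so it arises from C by further multiplications with the transposed
-- production matrix.  Writing 1 + p + q = 1 + tᶜ k + t k, with tᶜ k the other one of p and q, each
-- factor is the transfer matrix of a planar network with nonnegative weights: a composite of column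
-- scalings and of additions to a column of a nonnegative multiple of an adjacent column that is not
-- itself modified.  By multilinearity and the alternating property of the determinant, such
-- operations keep every minor a polynomial with nonnegative coefficients.

open import Defs

open import Algebra.Bundles using (CommutativeRing)
open import Data.Bool using (Bool; true; false; if_then_else_; _∧_; not; T)
import Data.Bool.Properties as BoolP
open import Data.Empty using (⊥-elim)
open import Data.Fin as Fin using (Fin; zero; suc; toℕ; punchIn; punchOut)
import Data.Fin.Properties as FinP
open import Data.Integer as ℤ using (ℤ; +_; -[1+_])
import Data.Integer.Properties as ℤP
open import Data.List using (List; []; _∷_; _++_; map; concatMap)
import Data.List.Properties as ListP
open import Data.List.Relation.Unary.All using (All; []; _∷_)
import Data.List.Relation.Unary.All.Properties as AllP
open import Data.Maybe using (nothing)
open import Data.Nat as ℕ using (ℕ; zero; suc; _∸_; _<_; _≤_; _<ᵇ_; s≤s; z≤n; ⌊_/2⌋)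
import Data.Nat.Properties as ℕP
open import Data.Product using (Σ; _×_; _,_; proj₁; proj₂)
open import Data.Sum using (_⊎_; inj₁; inj₂)
open import Function using (_∘_)
open import Function.Bundles using (Equivalence)
open import Level using (0ℓ)
open import Relation.Binary.PropositionalEquality
open import Relation.Nullary using (¬_)
open import Relation.Nullary.Decidable using (⌊_⌋; yes; no)
open import Tactic.RingSolver using (solve-∀)
open import Tactic.RingSolver.Core.AlmostCommutativeRing using (AlmostCommutativeRing; fromCommutativeRing)

open import Algebra.Properties.CommutativeSemigroup ℤP.+-commutativeSemigroup using (interchange)

-- Polynomials up to equality of coefficients

Monomial : Set
Monomial = ℤ × ℕ × ℕ

monoCoeff : Monomial → ℕ → ℕ → ℤ
monoCoeff (a , k , l) i j = if ⌊ k ℕ.≟ i ⌋ then (if ⌊ l ℕ.≟ j ⌋ then a else + 0) else + 0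

monoMul : Monomial → Monomial → Monomial
monoMul (a , i , j) (b , k , l) = (a ℤ.* b , i ℕ.+ k , j ℕ.+ l)

sumOver : List Monomial → (Monomial → ℤ) → ℤ
sumOver []       F = + 0
sumOver (m ∷ ms) F = F m ℤ.+ sumOver ms F

coeff-sumOver : ∀ f i j → coeff f i j ≡ sumOver f (λ m → monoCoeff m i j)
coeff-sumOver []      i j = refl
coeff-sumOver (m ∷ f) i j = cong (λ z → monoCoeff m i j ℤ.+ z) (coeff-sumOver f i j)

sumOver-++ : ∀ f g F → sumOver (f ++ g) F ≡ sumOver f F ℤ.+ sumOver g F
sumOver-++ []      g F = sym (ℤP.+-identityˡ _)
sumOver-++ (m ∷ f) g F =
  trans (cong (λ z → F m ℤ.+ z) (sumOver-++ f g F)) (sym (ℤP.+-assoc (F m) _ _))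

sumOver-map : ∀ (h : Monomial → Monomial) g F → sumOver (map h g) F ≡ sumOver g (λ m → F (h m))
sumOver-map h []      F = refl
sumOver-map h (m ∷ g) F = cong (λ z → F (h m) ℤ.+ z) (sumOver-map h g F)

sumOver-concatMap : ∀ (H : Monomial → List Monomial) f F →
                    sumOver (concatMap H f) F ≡ sumOver f (λ m → sumOver (H m) F)
sumOver-concatMap H []      F = refl
sumOver-concatMap H (m ∷ f) F =
  trans (sumOver-++ (H m) (concatMap H f) F)
        (cong (λ z → sumOver (H m) F ℤ.+ z) (sumOver-concatMap H f F))

sumOver-cong : ∀ f {F G} → (∀ m → F m ≡ G m) → sumOver f F ≡ sumOver f G
sumOver-cong []      e = refl
sumOver-cong (m ∷ f) e = cong₂ ℤ._+_ (e m) (sumOver-cong f e)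

sumOver-+ : ∀ f F G → sumOver f (λ m → F m ℤ.+ G m) ≡ sumOver f F ℤ.+ sumOver f G
sumOver-+ []      F G = refl
sumOver-+ (m ∷ f) F G =
  trans (cong (λ z → F m ℤ.+ G m ℤ.+ z) (sumOver-+ f F G)) (interchange (F m) (G m) _ _)

sumOver-zero : ∀ f → sumOver f (λ _ → + 0) ≡ + 0
sumOver-zero []      = refl
sumOver-zero (m ∷ f) = trans (ℤP.+-identityˡ _) (sumOver-zero f)

sumOver-*ˡ : ∀ a f F → sumOver f (λ m → a ℤ.* F m) ≡ a ℤ.* sumOver f F
sumOver-*ˡ a []      F = sym (ℤP.*-zeroʳ a)
sumOver-*ˡ a (m ∷ f) F =
  trans (cong (λ z → a ℤ.* F m ℤ.+ z) (sumOver-*ˡ a f F)) (sym (ℤP.*-distribˡ-+ a (F m) _))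

sumOver-swap : ∀ f g (F : Monomial → Monomial → ℤ) →
               sumOver f (λ m → sumOver g (F m)) ≡ sumOver g (λ m' → sumOver f (λ m → F m m'))
sumOver-swap []      g F = sym (sumOver-zero g)
sumOver-swap (m ∷ f) g F =
  trans (cong (λ z → sumOver g (F m) ℤ.+ z) (sumOver-swap f g F)) (sym (sumOver-+ g (F m) _))

infix 4 _≈_
record _≈_ (f g : Poly) : Set where
  constructor mk≈
  field coeff-≡ : ∀ i j → coeff f i j ≡ coeff g i j
open _≈_

≈-refl : ∀ {f} → f ≈ f
≈-refl = mk≈ λ i j → refl

≈-sym : ∀ {f g} → f ≈ g → g ≈ f
≈-sym (mk≈ e) = mk≈ λ i j → sym (e i j)

≈-trans : ∀ {f g h} → f ≈ g → g ≈ h → f ≈ h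
≈-trans (mk≈ e) (mk≈ e′) = mk≈ λ i j → trans (e i j) (e′ i j)

≡⇒≈ : ∀ {f g} → f ≡ g → f ≈ g
≡⇒≈ refl = ≈-refl

coeff-+ : ∀ f g i j → coeff (f +P g) i j ≡ coeff f i j ℤ.+ coeff g i j
coeff-+ []      g i j = sym (ℤP.+-identityˡ _)
coeff-+ (m ∷ f) g i j =
  trans (cong (λ z → monoCoeff m i j ℤ.+ z) (coeff-+ f g i j)) (sym (ℤP.+-assoc (monoCoeff m i j) _ _))

coeff-* : ∀ f g i j →
          coeff (f *P g) i j ≡ sumOver f (λ m → sumOver g (λ m′ → monoCoeff (monoMul m m′) i j))
coeff-* f g i j =
  trans (coeff-sumOver (f *P g) i j)
        (trans (sumOver-concatMap _ f _) (sumOver-cong f λ m → sumOver-map _ g _))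

-- The coefficient function of F · b p^k q^l.  The scalar b sits on the right so that
-- the junk value 0 · b reduces to 0.
coeffTimesMono : (ℕ → ℕ → ℤ) → Monomial → ℕ → ℕ → ℤ
coeffTimesMono F (b , k , l) i j =
  if (k ℕ.≤ᵇ i) ∧ (l ℕ.≤ᵇ j) then F (i ∸ k) (j ∸ l) ℤ.* b else + 0

⌊+≟⌋ : ∀ k k′ i → ⌊ k ℕ.+ k′ ℕ.≟ i ⌋ ≡ (k′ ℕ.≤ᵇ i) ∧ ⌊ k ℕ.≟ i ∸ k′ ⌋
⌊+≟⌋ k k′ i with k′ ℕ.≤ᵇ i in k′≤ᵇi | k ℕ.+ k′ ℕ.≟ i | k ℕ.≟ i ∸ k′
... | false | no  _      | _ = refl
... | false | yes k+k′≡i | _ =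
  ⊥-elim (subst T k′≤ᵇi (ℕP.≤⇒≤ᵇ (subst (k′ ℕ.≤_) k+k′≡i (ℕP.m≤n+m k′ k))))
... | true | yes _ | yes _ = refl
... | true | no  _ | no  _ = refl
... | true | yes k+k′≡i | no k≢i∸k′ =
  ⊥-elim (k≢i∸k′ (trans (sym (ℕP.m+n∸n≡m k k′)) (cong (_∸ k′) k+k′≡i)))
... | true | no k+k′≢i | yes k≡i∸k′ =
  ⊥-elim (k+k′≢i (trans (cong (ℕ._+ k′) k≡i∸k′)
                        (ℕP.m∸n+n≡m (ℕP.≤ᵇ⇒≤ k′ i (subst T (sym k′≤ᵇi) _)))))

monoCoeff-monoMul : ∀ m m′ i j →
                    monoCoeff (monoMul m m′) i j ≡ coeffTimesMono (monoCoeff m) m′ i j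
monoCoeff-monoMul (a , k , l) (b , k′ , l′) i j
  rewrite ⌊+≟⌋ k k′ i | ⌊+≟⌋ l l′ j
  with k′ ℕ.≤ᵇ i | l′ ℕ.≤ᵇ j | ⌊ k ℕ.≟ i ∸ k′ ⌋ | ⌊ l ℕ.≟ j ∸ l′ ⌋
... | true  | true  | true  | true  = refl
... | true  | true  | true  | false = refl
... | true  | true  | false | _     = refl
... | true  | false | true  | _     = refl
... | true  | false | false | _     = refl
... | false | _     | _     | _     = refl

sumOver-coeffTimesMono : ∀ f m′ i j →
  sumOver f (λ m → coeffTimesMono (monoCoeff m) m′ i j) ≡ coeffTimesMono (coeff f) m′ i j
sumOver-coeffTimesMono f (b , k′ , l′) i j with (k′ ℕ.≤ᵇ i) ∧ (l′ ℕ.≤ᵇ j)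
... | false = sumOver-zero f
... | true  = trans (sumOver-cong f λ m → ℤP.*-comm (monoCoeff m (i ∸ k′) (j ∸ l′)) b)
             (trans (sumOver-*ˡ b f _)
             (trans (ℤP.*-comm b _) (cong (ℤ._* b) (sym (coeff-sumOver f _ _)))))

coeff-*-byRightFactor : ∀ f g i j →
  coeff (f *P g) i j ≡ sumOver g (λ m′ → coeffTimesMono (coeff f) m′ i j)
coeff-*-byRightFactor f g i j =
  trans (coeff-* f g i j)
        (trans (sumOver-swap f g _)
               (sumOver-cong g λ m′ → trans (sumOver-cong f λ m → monoCoeff-monoMul m m′ i j)
                                            (sumOver-coeffTimesMono f m′ i j)))

coeffTimesMono-cong : ∀ {F G : ℕ → ℕ → ℤ} → (∀ i j → F i j ≡ G i j) →
                      ∀ m i j → coeffTimesMono F m i j ≡ coeffTimesMono G m i j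
coeffTimesMono-cong e (b , k , l) i j with (k ℕ.≤ᵇ i) ∧ (l ℕ.≤ᵇ j)
... | true  = cong (ℤ._* b) (e _ _)
... | false = refl

+-cong : ∀ {f f′ g g′} → f ≈ f′ → g ≈ g′ → f +P g ≈ f′ +P g′
+-cong {f} {f′} {g} {g′} (mk≈ e) (mk≈ e′) = mk≈ λ i j →
  trans (coeff-+ f g i j) (trans (cong₂ ℤ._+_ (e i j) (e′ i j)) (sym (coeff-+ f′ g′ i j)))

+-assoc : ∀ f g h → (f +P g) +P h ≈ f +P (g +P h)
+-assoc f g h = ≡⇒≈ (ListP.++-assoc f g h)

+-comm : ∀ f g → f +P g ≈ g +P f
+-comm f g = mk≈ λ i j →
  trans (coeff-+ f g i j) (trans (ℤP.+-comm (coeff f i j) _) (sym (coeff-+ g f i j)))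

+-identityʳ : ∀ f → f +P 0P ≈ f
+-identityʳ f = ≡⇒≈ (ListP.++-identityʳ f)

*-congʳ : ∀ g {f f′} → f ≈ f′ → f *P g ≈ f′ *P g
*-congʳ g {f} {f′} (mk≈ e) = mk≈ λ i j →
  trans (coeff-*-byRightFactor f g i j)
        (trans (sumOver-cong g λ m′ → coeffTimesMono-cong e m′ i j)
               (sym (coeff-*-byRightFactor f′ g i j)))

*-comm : ∀ f g → f *P g ≈ g *P f
*-comm f g = mk≈ λ i j →
  trans (coeff-* f g i j)
        (trans (sumOver-cong f λ m → sumOver-cong g λ m′ →
                  cong (λ z → monoCoeff z i j) (monoMul-comm m m′))
               (trans (sumOver-swap f g _) (sym (coeff-* g f i j))))
  where
  monoMul-comm : ∀ m m′ → monoMul m m′ ≡ monoMul m′ m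
  monoMul-comm (a , i , j) (b , k , l) =
    cong₂ _,_ (ℤP.*-comm a b) (cong₂ _,_ (ℕP.+-comm i k) (ℕP.+-comm j l))

*-congˡ : ∀ f {g g′} → g ≈ g′ → f *P g ≈ f *P g′
*-congˡ f {g} {g′} e = ≈-trans (*-comm f g) (≈-trans (*-congʳ f e) (*-comm g′ f))

*-cong : ∀ {f f′ g g′} → f ≈ f′ → g ≈ g′ → f *P g ≈ f′ *P g′
*-cong {f} {f′} {g} {g′} e e′ = ≈-trans (*-congʳ g e) (*-congˡ f′ e′)

+-congˡ : ∀ f {g g′} → g ≈ g′ → f +P g ≈ f +P g′
+-congˡ f = +-cong (≈-refl {f})

+-congʳ : ∀ g {f f′} → f ≈ f′ → f +P g ≈ f′ +P g
+-congʳ g e = +-cong e (≈-refl {g})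

*-assoc : ∀ f g h → (f *P g) *P h ≈ f *P (g *P h)
*-assoc f g h = mk≈ λ i j → begin
    coeff ((f *P g) *P h) i j
  ≡⟨ coeff-* (f *P g) h i j ⟩
    sumOver (f *P g) (λ m → sumOver h λ m″ → monoCoeff (monoMul m m″) i j)
  ≡⟨ expand f g _ ⟩
    sumOver f (λ m → sumOver g λ m′ → sumOver h λ m″ → monoCoeff (monoMul (monoMul m m′) m″) i j)
  ≡⟨ (sumOver-cong f λ m → sumOver-cong g λ m′ → sumOver-cong h λ m″ →
        cong (λ z → monoCoeff z i j) (monoMul-assoc m m′ m″)) ⟩
    sumOver f (λ m → sumOver g λ m′ → sumOver h λ m″ → monoCoeff (monoMul m (monoMul m′ m″)) i j)
  ≡⟨ sumOver-cong f (λ m → expand g h _) ⟨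
    sumOver f (λ m → sumOver (g *P h) λ m′ → monoCoeff (monoMul m m′) i j)
  ≡⟨ coeff-* f (g *P h) i j ⟨
    coeff (f *P (g *P h)) i j ∎
  where
  open ≡-Reasoning
  expand : ∀ f g F → sumOver (f *P g) F ≡ sumOver f (λ m → sumOver g λ m′ → F (monoMul m m′))
  expand f g F = trans (sumOver-concatMap _ f F) (sumOver-cong f λ m → sumOver-map _ g F)
  monoMul-assoc : ∀ m m′ m″ → monoMul (monoMul m m′) m″ ≡ monoMul m (monoMul m′ m″)
  monoMul-assoc (a , i , j) (b , k , l) (c , u , v) =
    cong₂ _,_ (ℤP.*-assoc a b c) (cong₂ _,_ (ℕP.+-assoc i k u) (ℕP.+-assoc j l v))

*-distribʳ-+ : ∀ h f g → (f +P g) *P h ≈ f *P h +P g *P h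
*-distribʳ-+ h f g = ≡⇒≈ (ListP.concatMap-++ _ f g)

*-distribˡ-+ : ∀ h f g → h *P (f +P g) ≈ h *P f +P h *P g
*-distribˡ-+ h f g = mk≈ λ i j →
  trans (coeff-* h (f +P g) i j)
  (trans (sumOver-cong h λ m → sumOver-++ f g _)
  (trans (sumOver-+ h _ _)
  (sym (trans (coeff-+ (h *P f) (h *P g) i j) (cong₂ ℤ._+_ (coeff-* h f i j) (coeff-* h g i j))))))

*-identityˡ : ∀ f → 1P *P f ≈ f
*-identityˡ f = mk≈ λ i j →
  trans (coeff-* 1P f i j)
  (trans (ℤP.+-identityʳ _)
  (trans (sumOver-cong f λ { (a , k , l) → cong (λ z → monoCoeff (z , k , l) i j) (ℤP.*-identityˡ a) })
         (sym (coeff-sumOver f i j))))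

*-identityʳ : ∀ f → f *P 1P ≈ f
*-identityʳ f = ≈-trans (*-comm f 1P) (*-identityˡ f)

*-zeroʳ : ∀ f → f *P 0P ≈ 0P
*-zeroʳ f = mk≈ λ i j → trans (coeff-* f 0P i j) (sumOver-zero f)

negP : Poly → Poly
negP f = const -[1+ 0 ] *P f

coeff-negP : ∀ f i j → coeff (negP f) i j ≡ ℤ.- coeff f i j
coeff-negP f i j =
  trans (coeff-* (const -[1+ 0 ]) f i j)
  (trans (ℤP.+-identityʳ _)
  (trans (sumOver-cong f (λ { (a , k , l) → monoCoeff-neg a k l }))
  (trans (sumOver-*ˡ -[1+ 0 ] f _)
  (trans (ℤP.-1*i≡-i _) (cong ℤ.-_ (sym (coeff-sumOver f i j)))))))
  where
  monoCoeff-neg : ∀ a k l →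
                  monoCoeff (-[1+ 0 ] ℤ.* a , k , l) i j ≡ -[1+ 0 ] ℤ.* monoCoeff (a , k , l) i j
  monoCoeff-neg a k l with ⌊ k ℕ.≟ i ⌋ | ⌊ l ℕ.≟ j ⌋
  ... | true  | true  = refl
  ... | true  | false = refl
  ... | false | _     = refl

+-inverseʳ : ∀ f → f +P negP f ≈ 0P
+-inverseʳ f = mk≈ λ i j →
  trans (coeff-+ f (negP f) i j)
        (trans (cong (λ z → coeff f i j ℤ.+ z) (coeff-negP f i j)) (ℤP.+-inverseʳ (coeff f i j)))

polyRing : CommutativeRing 0ℓ 0ℓ
polyRing = record
  { Carrier = Poly ; _≈_ = _≈_ ; _+_ = _+P_ ; _*_ = _*P_ ; -_ = negP ; 0# = 0P ; 1# = 1P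
  ; isCommutativeRing = record
    { isRing = record
      { +-isAbelianGroup = record
        { isGroup = record
          { isMonoid = record
            { isSemigroup = record
              { isMagma = record
                { isEquivalence = record { refl = ≈-refl ; sym = ≈-sym ; trans = ≈-trans }
                ; ∙-cong = +-cong }
              ; assoc = +-assoc }
            ; identity = (λ f → ≈-refl) , +-identityʳ }
          ; inverse = (λ f → ≈-trans (+-comm (negP f) f) (+-inverseʳ f)) , +-inverseʳ
          ; ⁻¹-cong = *-congˡ (const -[1+ 0 ]) }
        ; comm = +-comm }
      ; *-cong = *-cong
      ; *-assoc = *-assoc
      ; *-identity = *-identityˡ , *-identityʳ
      ; distrib = *-distribˡ-+ , *-distribʳ-+ }
    ; *-comm = *-comm } }

polyRing′ : AlmostCommutativeRing 0ℓ 0ℓ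
polyRing′ = fromCommutativeRing polyRing (λ _ → nothing)

-- Determinants

Matrix : ℕ → Set
Matrix n = Fin n → Fin n → Poly

minor : ∀ {n} → Matrix (suc n) → Fin (suc n) → Matrix n
minor M j a b = M (suc a) (punchIn j b)

laplaceTerm : ∀ {n} → Matrix (suc n) → Fin (suc n) → Poly
laplaceTerm {n} M j = sign (toℕ j) *P M zero j *P det n (minor M j)

sumFin-cong : ∀ n {f g : Fin n → Poly} → (∀ j → f j ≈ g j) → sumFin n f ≈ sumFin n g
sumFin-cong zero    e = ≈-refl
sumFin-cong (suc n) e = +-cong (e zero) (sumFin-cong n (λ j → e (suc j)))

sumFin-≈0 : ∀ n {f : Fin n → Poly} → (∀ j → f j ≈ 0P) → sumFin n f ≈ 0P
sumFin-≈0 zero    e = ≈-refl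
sumFin-≈0 (suc n) e = +-cong (e zero) (sumFin-≈0 n (λ j → e (suc j)))

sumFin-linear : ∀ n {f g h : Fin n → Poly} x → (∀ j → f j ≈ g j +P x *P h j) →
                sumFin n f ≈ sumFin n g +P x *P sumFin n h
sumFin-linear zero    x e = ≈-sym (*-zeroʳ x)
sumFin-linear (suc n) {f} {g} {h} x e =
  ≈-trans (+-cong (e zero) (sumFin-linear n x (λ j → e (suc j))))
          (regroup (g zero) (h zero) (sumFin n (λ j → g (suc j))) (sumFin n (λ j → h (suc j))) x)
  where
  regroup : ∀ a b c d x → (a +P x *P b) +P (c +P x *P d) ≈ (a +P c) +P x *P (b +P d)
  regroup = solve-∀ polyRing′

det-cong : ∀ n {M N : Matrix n} → (∀ a b → M a b ≈ N a b) → det n M ≈ det n N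
det-cong zero    e = ≈-refl
det-cong (suc n) e = sumFin-cong (suc n) λ j →
  *-cong (*-cong (≈-refl {sign (toℕ j)}) (e zero j)) (det-cong n (λ a b → e (suc a) (punchIn j b)))

det-linearInColumn : ∀ n (M N L : Matrix n) (k : Fin n) x →
  (∀ a b → b ≢ k → M a b ≈ N a b) → (∀ a b → b ≢ k → M a b ≈ L a b) →
  (∀ a → M a k ≈ N a k +P x *P L a k) → det n M ≈ det n N +P x *P det n L
det-linearInColumn (suc n) M N L k x eN eL ek = sumFin-linear (suc n) x termwise
  where
  termwise : ∀ j → laplaceTerm M j ≈ laplaceTerm N j +P x *P laplaceTerm L j
  termwise j with j FinP.≟ k
  ... | yes refl =
    ≈-trans (*-congʳ D (*-congˡ s (ek zero)))
    (≈-trans (expand s (N zero j) (L zero j) x D)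
    (+-cong (*-congˡ (s *P N zero j) (det-cong n λ a b → eN (suc a) (punchIn j b) (avoids-j b)))
            (*-congˡ x (*-congˡ (s *P L zero j) (det-cong n λ a b → eL (suc a) (punchIn j b) (avoids-j b))))))
    where
    s = sign (toℕ j)
    D = det n (minor M j)
    avoids-j = FinP.punchInᵢ≢i j
    expand : ∀ s a b x D → s *P (a +P x *P b) *P D ≈ s *P a *P D +P x *P (s *P b *P D)
    expand = solve-∀ polyRing′
  ... | no j≢k =
    ≈-trans (*-congˡ (s *P M zero j) minorLinear)
    (≈-trans (expand s (M zero j) x (det n (minor N j)) (det n (minor L j)))
    (+-cong (*-congʳ (det n (minor N j)) (*-congˡ s (eN zero j j≢k)))
            (*-congˡ x (*-congʳ (det n (minor L j)) (*-congˡ s (eL zero j j≢k))))))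
    where
    s = sign (toℕ j)
    expand : ∀ s m x D E → s *P m *P (D +P x *P E) ≈ s *P m *P D +P x *P (s *P m *P E)
    expand = solve-∀ polyRing′
    k′ = punchOut j≢k
    punchIn-k′ = FinP.punchIn-punchOut j≢k
    avoids-k : ∀ b → b ≢ k′ → punchIn j b ≢ k
    avoids-k b b≢k′ e = b≢k′ (FinP.punchIn-injective j b k′ (trans e (sym punchIn-k′)))
    minorLinear : det n (minor M j) ≈ det n (minor N j) +P x *P det n (minor L j)
    minorLinear = det-linearInColumn n (minor M j) (minor N j) (minor L j) k′ x
      (λ a b b≢k′ → eN (suc a) (punchIn j b) (avoids-k b b≢k′))
      (λ a b b≢k′ → eL (suc a) (punchIn j b) (avoids-k b b≢k′))
      (λ a → subst (λ z → M (suc a) z ≈ N (suc a) z +P x *P L (suc a) z) (sym punchIn-k′) (ek (suc a)))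

det-zeroColumn : ∀ n (M : Matrix n) (k : Fin n) → (∀ a → M a k ≈ 0P) → det n M ≈ 0P
det-zeroColumn n M k zero-k =
  ≈-trans (det-linearInColumn n M M M k (negP 1P) (λ _ _ _ → ≈-refl) (λ _ _ _ → ≈-refl)
             (λ a → ≈-trans (zero-k a) (≈-sym (selfCancel (M a k)))))
          (selfCancel (det n M))
  where
  selfCancel : ∀ m → m +P negP 1P *P m ≈ 0P
  selfCancel m =
    ≈-trans (+-congˡ m (≈-trans (*-assoc (const -[1+ 0 ]) 1P m) (*-congˡ (const -[1+ 0 ]) (*-identityˡ m))))
            (+-inverseʳ m)

sign-suc : ∀ m → sign (suc m) ≈ negP (sign m)
sign-suc zero    = ≈-sym (≈-trans (*-comm (const -[1+ 0 ]) 1P) (*-identityˡ (const -[1+ 0 ])))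
sign-suc (suc m) =
  ≈-trans (≈-sym (negP-involutive (sign m))) (*-congˡ (const -[1+ 0 ]) (≈-sym (sign-suc m)))
  where
  negP-involutive : ∀ x → negP (negP x) ≈ x
  negP-involutive = solve-∀ polyRing′

punchIn-adjacent : ∀ {n} {k k′ : Fin (suc n)} → toℕ k′ ≡ suc (toℕ k) → ∀ b →
                   punchIn k b ≡ punchIn k′ b ⊎ (punchIn k b ≡ k′ × punchIn k′ b ≡ k)
punchIn-adjacent {k = zero}  {suc zero} refl zero    = inj₂ (refl , refl)
punchIn-adjacent {k = zero}  {suc zero} refl (suc b) = inj₁ refl
punchIn-adjacent {k = suc k} {suc k′}   e    zero    = inj₁ refl
punchIn-adjacent {k = suc k} {suc k′}   e    (suc b) with punchIn-adjacent (ℕP.suc-injective e) b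
... | inj₁ e′        = inj₁ (cong suc e′)
... | inj₂ (e₁ , e₂) = inj₂ (cong suc e₁ , cong suc e₂)

punchOut-adjacent : ∀ {n} {j k k′ : Fin (suc n)} (j≢k : j ≢ k) (j≢k′ : j ≢ k′) →
                    toℕ k′ ≡ suc (toℕ k) → toℕ (punchOut j≢k′) ≡ suc (toℕ (punchOut j≢k))
punchOut-adjacent {j = zero}                {zero}  j≢k _    _    = ⊥-elim (j≢k refl)
punchOut-adjacent {j = zero}                {suc k} {suc k′} _ _ e = ℕP.suc-injective e
punchOut-adjacent {suc n}       {suc zero}    {zero}  {suc zero} _ j≢k′ refl = ⊥-elim (j≢k′ refl)
punchOut-adjacent {suc (suc n)} {suc (suc j)} {zero}  {suc zero} _ _    refl = refl
punchOut-adjacent {suc n}       {suc j}       {suc k} {suc k′} j≢k j≢k′ e =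
  cong suc (punchOut-adjacent (j≢k ∘ cong suc) (j≢k′ ∘ cong suc) (ℕP.suc-injective e))

sumFin-≈0-exceptAdjacent : ∀ n (f : Fin n → Poly) (k k′ : Fin n) → toℕ k′ ≡ suc (toℕ k) →
  (∀ j → j ≢ k → j ≢ k′ → f j ≈ 0P) → f k +P f k′ ≈ 0P → sumFin n f ≈ 0P
sumFin-≈0-exceptAdjacent (suc (suc n)) f zero (suc zero) refl others pair =
  ≈-trans (≈-sym (+-assoc (f zero) (f (suc zero)) _))
          (+-cong pair (sumFin-≈0 n λ j → others (suc (suc j)) (λ ()) (λ ())))
sumFin-≈0-exceptAdjacent (suc n) f (suc k) (suc k′) adj others pair =
  +-cong (others zero (λ ()) (λ ()))
         (sumFin-≈0-exceptAdjacent n (λ j → f (suc j)) k k′ (ℕP.suc-injective adj)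
            (λ j j≢k j≢k′ → others (suc j) (j≢k ∘ FinP.suc-injective) (j≢k′ ∘ FinP.suc-injective))
            pair)

det-adjacentEqualColumns : ∀ n (M : Matrix n) (k k′ : Fin n) → toℕ k′ ≡ suc (toℕ k) →
                           (∀ a → M a k ≈ M a k′) → det n M ≈ 0P
det-adjacentEqualColumns (suc n) M k k′ adj eq =
  sumFin-≈0-exceptAdjacent (suc n) (laplaceTerm M) k k′ adj others pair
  where
  sameMinors : ∀ a b → minor M k′ a b ≈ minor M k a b
  sameMinors a b with punchIn-adjacent adj b
  ... | inj₁ e         = ≡⇒≈ (cong (M (suc a)) (sym e))
  ... | inj₂ (e₁ , e₂) = subst₂ (λ u v → M (suc a) u ≈ M (suc a) v) (sym e₂) (sym e₁) (eq (suc a))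

  pair : laplaceTerm M k +P laplaceTerm M k′ ≈ 0P
  pair =
    ≈-trans (+-congˡ (laplaceTerm M k) (*-cong (*-cong signFlip (≈-sym (eq zero))) (det-cong n sameMinors)))
    (≈-trans (negP-outward (sign (toℕ k)) (M zero k) (det n (minor M k))) (+-inverseʳ (laplaceTerm M k)))
    where
    signFlip : sign (toℕ k′) ≈ negP (sign (toℕ k))
    signFlip = subst (λ w → sign w ≈ negP (sign (toℕ k))) (sym adj) (sign-suc (toℕ k))
    negP-outward : ∀ s a D → s *P a *P D +P negP s *P a *P D ≈ s *P a *P D +P negP (s *P a *P D)
    negP-outward = solve-∀ polyRing′

  others : ∀ j → j ≢ k → j ≢ k′ → laplaceTerm M j ≈ 0P
  others j j≢k j≢k′ =
    ≈-trans (*-congˡ (sign (toℕ j) *P M zero j)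
              (det-adjacentEqualColumns n (minor M j) (punchOut j≢k) (punchOut j≢k′)
                 (punchOut-adjacent j≢k j≢k′ adj) minorColumnsEqual))
            (*-zeroʳ (sign (toℕ j) *P M zero j))
    where
    minorColumnsEqual : ∀ a → minor M j a (punchOut j≢k) ≈ minor M j a (punchOut j≢k′)
    minorColumnsEqual a = subst₂ (λ u v → M (suc a) u ≈ M (suc a) v)
                            (sym (FinP.punchIn-punchOut j≢k)) (sym (FinP.punchIn-punchOut j≢k′)) (eq (suc a))

-- Polynomials with nonnegative coefficients

NonnegMonomial : Monomial → Set
NonnegMonomial (a , _ , _) = Σ ℕ λ n → a ≡ + n

-- A representative all of whose monomials are nonnegative; unlike `NonnegCoeffs`,
-- this is evidently closed under products.
Nonneg : Poly → Set
Nonneg f = Σ Poly λ g → All NonnegMonomial g × f ≈ g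

Nonneg-resp-≈ : ∀ {f f′} → f ≈ f′ → Nonneg f → Nonneg f′
Nonneg-resp-≈ e (g , g≥0 , f≈g) = g , g≥0 , ≈-trans (≈-sym e) f≈g

Nonneg-0P : Nonneg 0P
Nonneg-0P = [] , [] , ≈-refl

Nonneg-≈0 : ∀ {f} → f ≈ 0P → Nonneg f
Nonneg-≈0 e = Nonneg-resp-≈ (≈-sym e) Nonneg-0P

Nonneg-1P : Nonneg 1P
Nonneg-1P = 1P , (1 , refl) ∷ [] , ≈-refl

Nonneg-pP : Nonneg pP
Nonneg-pP = pP , (1 , refl) ∷ [] , ≈-refl

Nonneg-qP : Nonneg qP
Nonneg-qP = qP , (1 , refl) ∷ [] , ≈-refl

Nonneg-+ : ∀ {f g} → Nonneg f → Nonneg g → Nonneg (f +P g)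
Nonneg-+ (f′ , f′≥0 , e) (g′ , g′≥0 , e′) = f′ ++ g′ , AllP.++⁺ f′≥0 g′≥0 , +-cong e e′

Nonneg-* : ∀ {f g} → Nonneg f → Nonneg g → Nonneg (f *P g)
Nonneg-* (f′ , f′≥0 , e) (g′ , g′≥0 , e′) = f′ *P g′ , allNonneg-* f′ f′≥0 , *-cong e e′
  where
  allNonneg-* : ∀ f → All NonnegMonomial f → All NonnegMonomial (f *P g′)
  allNonneg-* []      []          = []
  allNonneg-* (m ∷ f) (m≥0 ∷ f≥0) = AllP.++⁺ (AllP.map⁺ (scaled g′ g′≥0)) (allNonneg-* f f≥0)
    where
    scaled : ∀ h → All NonnegMonomial h → All (NonnegMonomial ∘ monoMul m) h
    scaled []      []          = []
    scaled (_ ∷ h) (m′≥0 ∷ h≥0) =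
      (proj₁ m≥0 ℕ.* proj₁ m′≥0 ,
       trans (cong₂ ℤ._*_ (proj₂ m≥0) (proj₂ m′≥0)) (sym (ℤP.pos-* (proj₁ m≥0) (proj₁ m′≥0))))
      ∷ scaled h h≥0

AllNonneg : (ℕ → Poly) → Set
AllNonneg a = ∀ c → Nonneg (a c)

Nonneg-sumFin : ∀ n (f : Fin n → Poly) → (∀ j → Nonneg (f j)) → Nonneg (sumFin n f)
Nonneg-sumFin zero    f f≥0 = Nonneg-0P
Nonneg-sumFin (suc n) f f≥0 = Nonneg-+ (f≥0 zero) (Nonneg-sumFin n (f ∘ suc) (f≥0 ∘ suc))

Nonneg⇒NonnegCoeffs : ∀ {f} → Nonneg f → NonnegCoeffs f
Nonneg⇒NonnegCoeffs (g , g≥0 , mk≈ e) i j = subst (+ 0 ℤ.≤_) (sym (e i j)) (coeff-nonneg g g≥0)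
  where
  coeff-nonneg : ∀ g → All NonnegMonomial g → + 0 ℤ.≤ coeff g i j
  coeff-nonneg []                []              = ℤ.+≤+ ℕ.z≤n
  coeff-nonneg ((_ , k , l) ∷ g) ((n , refl) ∷ g≥0) =
    ℤP.+-mono-≤ (monoCoeff-nonneg ⌊ k ℕ.≟ i ⌋ ⌊ l ℕ.≟ j ⌋) (coeff-nonneg g g≥0)
    where
    monoCoeff-nonneg : ∀ b b′ → + 0 ℤ.≤ (if b then (if b′ then + n else + 0) else + 0)
    monoCoeff-nonneg true  true  = ℤ.+≤+ ℕ.z≤n
    monoCoeff-nonneg true  false = ℤ.+≤+ ℕ.z≤n
    monoCoeff-nonneg false _     = ℤ.+≤+ ℕ.z≤n

-- Total positivity and elementary column operations

T⇒≡true : ∀ {b} → T b → b ≡ true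
T⇒≡true = Equivalence.to BoolP.T-≡

<ᵇ-true : ∀ {m n} → m < n → (m <ᵇ n) ≡ true
<ᵇ-true m<n = T⇒≡true (ℕP.<⇒<ᵇ m<n)

<ᵇ-false : ∀ {m n} → ¬ m < n → (m <ᵇ n) ≡ false
<ᵇ-false {m} {n} m≮n with m <ᵇ n in eq
... | false = refl
... | true  = ⊥-elim (m≮n (ℕP.<ᵇ⇒< m n (subst T (sym eq) _)))

<ᵇ-suc : ∀ m k → m ≢ k → (m <ᵇ suc k) ≡ (m <ᵇ k)
<ᵇ-suc m k m≢k with m ℕP.<? k
... | yes m<k = trans (<ᵇ-true (ℕP.m<n⇒m<1+n m<k)) (sym (<ᵇ-true m<k))
... | no  m≮k = trans (<ᵇ-false (λ m<1+k → m≮k (ℕP.≤∧≢⇒< (ℕP.≤-pred m<1+k) m≢k))) (sym (<ᵇ-false m≮k))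

StrictlyIncreasing-≤ : ∀ {r} {J : Fin r → ℕ} → StrictlyIncreasing J →
                       ∀ a b → toℕ a ≤ toℕ b → J a ≤ J b
StrictlyIncreasing-≤ {J = J} sJ a b a≤b with toℕ a ℕP.≟ toℕ b
... | yes a≡b = ℕP.≤-reflexive (cong J (FinP.toℕ-injective a≡b))
... | no  a≢b = ℕP.<⇒≤ (sJ a b (ℕP.≤∧≢⇒< a≤b a≢b))

StrictlyIncreasing-adjacent : ∀ {r} {J : Fin r → ℕ} → StrictlyIncreasing J →
                              ∀ p b → J b ≡ suc (J p) → toℕ b ≡ suc (toℕ p)
StrictlyIncreasing-adjacent {r} {J} sJ p b Jb≡1+Jp with toℕ p ℕP.<? toℕ b
... | no p≮b = ⊥-elim (ℕP.<-irrefl refl (ℕP.<-≤-trans (subst (J p <_) (sym Jb≡1+Jp) (ℕP.n<1+n (J p)))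
                                                    (StrictlyIncreasing-≤ sJ b p (ℕP.≮⇒≥ p≮b))))
... | yes p<b with suc (toℕ p) ℕP.≟ toℕ b
...   | yes e   = sym e
...   | no  1+p≢b = ⊥-elim (ℕP.<-irrefl refl (ℕP.<-≤-trans (sJ between b between<b)
                                 (subst (_≤ J between) (sym Jb≡1+Jp) (sJ p between p<between))))
  where
  1+p<b : suc (toℕ p) < toℕ b
  1+p<b = ℕP.≤∧≢⇒< p<b 1+p≢b
  between : Fin r
  between = Fin.fromℕ< (ℕP.<-trans 1+p<b (FinP.toℕ<n b))
  p<between : toℕ p < toℕ between
  p<between = subst (toℕ p <_) (sym (FinP.toℕ-fromℕ< _)) (ℕP.n<1+n _)
  between<b : toℕ between < toℕ b
  between<b = subst (_< toℕ b) (sym (FinP.toℕ-fromℕ< _)) 1+p<b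

InfMatrix : Set
InfMatrix = ℕ → ℕ → Poly

submatrix : ∀ {r} → InfMatrix → (Fin r → ℕ) → (Fin r → ℕ) → Matrix r
submatrix M I J a b = M (I a) (J b)

TotallyPositive : InfMatrix → Set
TotallyPositive M = ∀ r (I J : Fin r → ℕ) → StrictlyIncreasing I → StrictlyIncreasing J →
                    Nonneg (det r (submatrix M I J))

TotallyPositive-resp-≈ : ∀ {M N} → (∀ n m → M n m ≈ N n m) → TotallyPositive M → TotallyPositive N
TotallyPositive-resp-≈ e tp r I J sI sJ =
  Nonneg-resp-≈ (det-cong r (λ a b → e (I a) (J b))) (tp r I J sI sJ)

mixColumns : ∀ {r} (M N : InfMatrix) (k : ℕ) (I J : Fin r → ℕ) → Matrix r
mixColumns M N k I J a b = if toℕ b <ᵇ k then N (I a) (J b) else M (I a) (J b)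

mixColumns-suc : ∀ {r} M N (p : Fin r) I J a b → b ≢ p →
                 mixColumns M N (suc (toℕ p)) I J a b ≡ mixColumns M N (toℕ p) I J a b
mixColumns-suc M N p I J a b b≢p rewrite <ᵇ-suc (toℕ b) (toℕ p) (b≢p ∘ FinP.toℕ-injective) = refl

mixColumns-at : ∀ {r} M N (p : Fin r) I J a →
  mixColumns M N (suc (toℕ p)) I J a p ≡ N (I a) (J p) × mixColumns M N (toℕ p) I J a p ≡ M (I a) (J p)
mixColumns-at M N p I J a
  rewrite <ᵇ-true (ℕP.n<1+n (toℕ p)) | <ᵇ-false (ℕP.<-irrefl (refl {x = toℕ p})) = refl , refl

-- The hypothesis ranges over all column sets J′: expanding a modified column by linearity can
-- bring in a column of M outside J.
ColumnStep : InfMatrix → InfMatrix → Set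
ColumnStep M N = ∀ r (I J : Fin r → ℕ) (p : Fin r) → StrictlyIncreasing I → StrictlyIncreasing J →
  (∀ J′ → StrictlyIncreasing J′ → Nonneg (det r (mixColumns M N (toℕ p) I J′))) →
  Nonneg (det r (mixColumns M N (suc (toℕ p)) I J))

TotallyPositive-columnwise : ∀ M N → ColumnStep M N → TotallyPositive M → TotallyPositive N
TotallyPositive-columnwise M N step tp r I J sI sJ =
  Nonneg-resp-≈ (det-cong r allFromN) (mixed r ℕP.≤-refl J sJ)
  where
  allFromN : ∀ a b → mixColumns M N r I J a b ≈ N (I a) (J b)
  allFromN a b rewrite <ᵇ-true (FinP.toℕ<n b) = ≈-refl
  mixed : ∀ k → k ≤ r → ∀ J → StrictlyIncreasing J → Nonneg (det r (mixColumns M N k I J))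
  mixed zero    _   J sJ = tp r I J sI sJ
  mixed (suc k) k<r J sJ =
    subst (λ z → Nonneg (det r (mixColumns M N (suc z) I J))) (FinP.toℕ-fromℕ< k<r)
      (step r I J (Fin.fromℕ< k<r) sI sJ λ J′ sJ′ →
        subst (λ z → Nonneg (det r (mixColumns M N z I J′))) (sym (FinP.toℕ-fromℕ< k<r))
          (mixed k (ℕP.<⇒≤ k<r) J′ sJ′))

replaceAt : ∀ {r} {A : Set} → (Fin r → A) → Fin r → A → Fin r → A
replaceAt J p v b with b FinP.≟ p
... | yes _ = v
... | no  _ = J b

replaceAt-at : ∀ {r} {A : Set} (J : Fin r → A) p v → replaceAt J p v p ≡ v
replaceAt-at J p v with p FinP.≟ p
... | yes _   = refl
... | no  p≢p = ⊥-elim (p≢p refl)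

replaceAt-other : ∀ {r} {A : Set} (J : Fin r → A) p v b → b ≢ p → replaceAt J p v b ≡ J b
replaceAt-other J p v b b≢p with b FinP.≟ p
... | yes b≡p = ⊥-elim (b≢p b≡p)
... | no  _   = refl

replaceColumn : ∀ {r} → Matrix r → Fin r → (Fin r → Poly) → Matrix r
replaceColumn A p col a = replaceAt (A a) p (col a)

addNeighbourColumns : (ℕ → Bool) → (ℕ → ℕ) → (ℕ → Poly) → InfMatrix → InfMatrix
addNeighbourColumns targeted σ x M n y = if targeted y then M n y +P x y *P M n (σ y) else M n y

module AddNeighbourColumns
  (targeted : ℕ → Bool) (σ : ℕ → ℕ) (x : ℕ → Poly) (x≥0 : AllNonneg x)
  (σ-untargeted : ∀ y → targeted y ≡ true → targeted (σ y) ≡ false)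
  (σ-neighbour : ∀ y → targeted y ≡ true → σ y ≡ suc y ⊎ suc (σ y) ≡ y)
  (M : InfMatrix) where

  N : InfMatrix
  N = addNeighbourColumns targeted σ x M

  mixColumns-untargeted : ∀ {r} k (I J : Fin r → ℕ) a b → targeted (J b) ≡ false →
                          mixColumns M N k I J a b ≈ M (I a) (J b)
  mixColumns-untargeted k I J a b untargeted with toℕ b <ᵇ k
  ... | false = ≈-refl
  ... | true rewrite untargeted = ≈-refl

  -- By linearity, modifying column p of the mixed submatrix A adds x (J p) · det L, where L is A
  -- with column p replaced by column σ (J p) of M.  Either σ (J p) is already selected, and L has
  -- two equal adjacent columns, or L is the mixed submatrix for J with J p replaced by σ (J p).
  module TargetedColumn {r} (I J : Fin r → ℕ) (p : Fin r) (targeted-Jp : targeted (J p) ≡ true) where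
    A L : Matrix r
    A = mixColumns M N (toℕ p) I J
    L = replaceColumn A p (λ a → M (I a) (σ (J p)))

    linear : det r (mixColumns M N (suc (toℕ p)) I J) ≈ det r A +P x (J p) *P det r L
    linear = det-linearInColumn r _ A L p (x (J p))
      (λ a b b≢p → ≡⇒≈ (mixColumns-suc M N p I J a b b≢p))
      (λ a b b≢p → ≡⇒≈ (trans (mixColumns-suc M N p I J a b b≢p) (sym (replaceAt-other (A a) p _ b b≢p))))
      columnP
      where
      columnP : ∀ a → mixColumns M N (suc (toℕ p)) I J a p ≈ A a p +P x (J p) *P L a p
      columnP a rewrite proj₁ (mixColumns-at M N p I J a) | proj₂ (mixColumns-at M N p I J a)
                      | targeted-Jp | replaceAt-at (A a) p (M (I a) (σ (J p))) = ≈-refl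

    module _ {b} (Jb≡σJp : J b ≡ σ (J p)) where
      σJp-untargeted : targeted (J b) ≡ false
      σJp-untargeted = trans (cong targeted Jb≡σJp) (σ-untargeted (J p) targeted-Jp)

      b≢p : b ≢ p
      b≢p refl with trans (sym σJp-untargeted) targeted-Jp
      ... | ()

      L-b : ∀ a → L a b ≈ M (I a) (σ (J p))
      L-b a = ≈-trans (≡⇒≈ (replaceAt-other (A a) p _ b b≢p))
              (≈-trans (mixColumns-untargeted (toℕ p) I J a b σJp-untargeted) (≡⇒≈ (cong (M (I a)) Jb≡σJp)))

      L-p : ∀ a → L a p ≈ M (I a) (σ (J p))
      L-p a = ≡⇒≈ (replaceAt-at (A a) p _)

      L-selected : StrictlyIncreasing J → det r L ≈ 0P
      L-selected sJ with σ-neighbour (J p) targeted-Jp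
      ... | inj₁ e = det-adjacentEqualColumns r L p b (StrictlyIncreasing-adjacent sJ p b (trans Jb≡σJp e))
                       (λ a → ≈-trans (L-p a) (≈-sym (L-b a)))
      ... | inj₂ e = det-adjacentEqualColumns r L b p
                       (StrictlyIncreasing-adjacent sJ b p (trans (sym e) (cong suc (sym Jb≡σJp))))
                       (λ a → ≈-trans (L-b a) (≈-sym (L-p a)))

    J′ : Fin r → ℕ
    J′ = replaceAt J p (σ (J p))

    J′-increasing : StrictlyIncreasing J → (∀ b → J b ≢ σ (J p)) → StrictlyIncreasing J′
    J′-increasing sJ σJp∉J a b a<b with a FinP.≟ p | b FinP.≟ p | σ-neighbour (J p) targeted-Jp
    ... | yes refl | yes refl | _      = ⊥-elim (ℕP.<-irrefl refl a<b)
    ... | yes refl | no  _    | inj₁ e = ℕP.≤∧≢⇒< (subst (_≤ J b) (sym e) (sJ p b a<b)) (σJp∉J b ∘ sym)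
    ... | yes refl | no  _    | inj₂ e = ℕP.<-trans (subst (σ (J p) <_) e (ℕP.n<1+n _)) (sJ p b a<b)
    ... | no  _    | yes refl | inj₁ e = subst (J a <_) (sym e) (ℕP.m<n⇒m<1+n (sJ a p a<b))
    ... | no  _    | yes refl | inj₂ e = ℕP.≤∧≢⇒< (ℕP.≤-pred (subst (J a <_) (sym e) (sJ a p a<b))) (σJp∉J a)
    ... | no  _    | no  _    | _      = sJ a b a<b

    L-unselected : ∀ a b → mixColumns M N (toℕ p) I J′ a b ≈ L a b
    L-unselected a b with b FinP.≟ p
    ... | yes refl rewrite <ᵇ-false (ℕP.<-irrefl (refl {x = toℕ p})) = ≈-refl
    ... | no  _    = ≈-refl

  step : ColumnStep M N
  step r I J p sI sJ ih with targeted (J p) in targeted-Jp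
  ... | false = Nonneg-resp-≈ (det-cong r unchanged) (ih J sJ)
    where
    unchanged : ∀ a b → mixColumns M N (toℕ p) I J a b ≈ mixColumns M N (suc (toℕ p)) I J a b
    unchanged a b with b FinP.≟ p
    ... | no  b≢p  = ≡⇒≈ (sym (mixColumns-suc M N p I J a b b≢p))
    ... | yes refl = ≈-trans (mixColumns-untargeted (toℕ p) I J a b targeted-Jp)
                             (≈-sym (mixColumns-untargeted (suc (toℕ p)) I J a b targeted-Jp))
  ... | true = Nonneg-resp-≈ (≈-sym linear) (Nonneg-+ (ih J sJ) (Nonneg-* (x≥0 (J p)) L≥0))
    where
    open TargetedColumn I J p targeted-Jp
    L≥0 : Nonneg (det r L)
    L≥0 with FinP.any? (λ b → J b ℕ.≟ σ (J p))
    ... | yes (b , Jb≡σJp) = Nonneg-≈0 (L-selected Jb≡σJp sJ)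
    ... | no  σJp∉J        = Nonneg-resp-≈ (det-cong r L-unselected)
                               (ih J′ (J′-increasing sJ λ b Jb≡σJp → σJp∉J (b , Jb≡σJp)))

  addNeighbourColumns-TP : TotallyPositive M → TotallyPositive N
  addNeighbourColumns-TP = TotallyPositive-columnwise M N step

open AddNeighbourColumns using (addNeighbourColumns-TP)

scaleColumns : (ℕ → Bool) → (ℕ → Poly) → InfMatrix → InfMatrix
scaleColumns targeted w M n y = if targeted y then w y *P M n y else M n y

module ScaleColumns (targeted : ℕ → Bool) (w : ℕ → Poly) (w≥0 : AllNonneg w) (M : InfMatrix)
  where

  N : InfMatrix
  N = scaleColumns targeted w M

  step : ColumnStep M N
  step r I J p sI sJ ih with targeted (J p) in targeted-Jp
  ... | false = Nonneg-resp-≈ (det-cong r unchanged) (ih J sJ)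
    where
    unchanged : ∀ a b → mixColumns M N (toℕ p) I J a b ≈ mixColumns M N (suc (toℕ p)) I J a b
    unchanged a b with b FinP.≟ p
    ... | no  b≢p  = ≡⇒≈ (sym (mixColumns-suc M N p I J a b b≢p))
    ... | yes refl rewrite proj₁ (mixColumns-at M N p I J a) | proj₂ (mixColumns-at M N p I J a)
                         | targeted-Jp = ≈-refl
  ... | true = Nonneg-resp-≈ (≈-sym linear)
                 (Nonneg-+ (Nonneg-≈0 zeroColumn) (Nonneg-* (w≥0 (J p)) (ih J sJ)))
    where
    A = mixColumns M N (toℕ p) I J
    Z = replaceColumn A p (λ _ → 0P)
    zeroColumn : det r Z ≈ 0P
    zeroColumn = det-zeroColumn r Z p (λ a → ≡⇒≈ (replaceAt-at (A a) p _))
    linear : det r (mixColumns M N (suc (toℕ p)) I J) ≈ det r Z +P w (J p) *P det r A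
    linear = det-linearInColumn r _ Z A p (w (J p))
      (λ a b b≢p → ≡⇒≈ (trans (mixColumns-suc M N p I J a b b≢p) (sym (replaceAt-other (A a) p _ b b≢p))))
      (λ a b b≢p → ≡⇒≈ (mixColumns-suc M N p I J a b b≢p))
      scaled
      where
      scaled : ∀ a → mixColumns M N (suc (toℕ p)) I J a p ≈ Z a p +P w (J p) *P A a p
      scaled a rewrite proj₁ (mixColumns-at M N p I J a) | proj₂ (mixColumns-at M N p I J a)
                     | targeted-Jp | replaceAt-at (A a) p 0P = ≈-refl

  scaleColumns-TP : TotallyPositive M → TotallyPositive N
  scaleColumns-TP = TotallyPositive-columnwise M N step

open ScaleColumns using (scaleColumns-TP)

diagonal : (ℕ → Poly) → InfMatrix
diagonal d n k = if n ℕ.≡ᵇ k then d n else 0P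

diagonal-offDiagonal : ∀ d {n k} → n ≢ k → diagonal d n k ≈ 0P
diagonal-offDiagonal d {n} {k} n≢k with n ℕ.≡ᵇ k in eq
... | false = ≈-refl
... | true  = ⊥-elim (n≢k (ℕP.≡ᵇ⇒≡ n k (subst T (sym eq) _)))

diagonal-TP : ∀ d → AllNonneg d → TotallyPositive (diagonal d)
diagonal-TP d d≥0 zero    I J sI sJ = Nonneg-1P
diagonal-TP d d≥0 (suc r) I J sI sJ = Nonneg-sumFin (suc r) (laplaceTerm D) term≥0
  where
  D = submatrix (diagonal d) I J

  vanishing : ∀ j → D zero j ≈ 0P ⊎ det r (minor D j) ≈ 0P → laplaceTerm D j ≈ 0P
  vanishing j (inj₁ e) =
    *-congʳ (det r (minor D j)) (≈-trans (*-congˡ (sign (toℕ j)) e) (*-zeroʳ (sign (toℕ j))))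
  vanishing j (inj₂ e) = ≈-trans (*-congˡ (sign (toℕ j) *P D zero j) e) (*-zeroʳ (sign (toℕ j) *P D zero j))

  term≥0 : ∀ j → Nonneg (laplaceTerm D j)
  term≥0 j with I zero ℕ.≟ J j
  ... | no I₀≢Jⱼ = Nonneg-≈0 (vanishing j (inj₁ (diagonal-offDiagonal d I₀≢Jⱼ)))
  term≥0 zero | yes I₀≡J₀ =
    Nonneg-* (Nonneg-* Nonneg-1P (Nonneg-resp-≈ (≡⇒≈ (sym diagonalEntry)) (d≥0 (I zero))))
             (diagonal-TP d d≥0 r (I ∘ suc) (J ∘ suc) (λ a b a<b → sI (suc a) (suc b) (s≤s a<b))
                                                     (λ a b a<b → sJ (suc a) (suc b) (s≤s a<b)))
    where
    diagonalEntry : D zero zero ≡ d (I zero)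
    diagonalEntry rewrite I₀≡J₀ | T⇒≡true (ℕP.≡⇒≡ᵇ (J zero) (J zero) refl) = refl
  -- Column J 0 of this minor meets only rows I (suc a) > I 0 = J j > J 0, hence vanishes.
  term≥0 (suc j) | yes I₀≡Jⱼ = Nonneg-≈0 (vanishing (suc j) (inj₂ zeroColumn))
    where
    first : ∀ {r} → Fin r → Fin r
    first {suc _} _ = zero
    punchIn-first : ∀ {r} (j : Fin r) → punchIn (suc j) (first j) ≡ zero
    punchIn-first {suc _} _ = refl
    zeroColumn : det r (minor D (suc j)) ≈ 0P
    zeroColumn = det-zeroColumn r (minor D (suc j)) (first j) λ a →
      subst (λ c → diagonal d (I (suc a)) (J c) ≈ 0P) (sym (punchIn-first j))
        (diagonal-offDiagonal d λ I₁₊ₐ≡J₀ → ℕP.<-irrefl (sym I₁₊ₐ≡J₀)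
          (ℕP.<-trans (sJ zero (suc j) (s≤s z≤n))
                      (subst (_< I (suc a)) I₀≡Jⱼ (sI zero (suc a) (s≤s z≤n)))))

-- Banded column operations

double : ℕ → ℕ
double zero    = zero
double (suc n) = suc (suc (double n))

even : ℕ → Bool
even zero          = true
even (suc zero)    = false
even (suc (suc n)) = even n

odd : ℕ → Bool
odd n = not (even n)

even-double : ∀ c → even (double c) ≡ true
even-double zero    = refl
even-double (suc c) = even-double c

even-suc-double : ∀ c → even (suc (double c)) ≡ false
even-suc-double zero    = refl
even-suc-double (suc c) = even-suc-double c

even-suc : ∀ y → even (suc y) ≡ not (even y)
even-suc zero          = refl
even-suc (suc zero)    = refl
even-suc (suc (suc y)) = even-suc y

⌊double/2⌋ : ∀ c → ⌊ double c /2⌋ ≡ c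
⌊double/2⌋ zero    = refl
⌊double/2⌋ (suc c) = cong suc (⌊double/2⌋ c)

⌊suc-double/2⌋ : ∀ c → ⌊ suc (double c) /2⌋ ≡ c
⌊suc-double/2⌋ zero    = refl
⌊suc-double/2⌋ (suc c) = cong suc (⌊suc-double/2⌋ c)

double-⌊/2⌋ : ∀ y → even y ≡ true → double ⌊ y /2⌋ ≡ y
double-⌊/2⌋ zero          _    = refl
double-⌊/2⌋ (suc (suc y)) even = cong (λ n → suc (suc n)) (double-⌊/2⌋ y even)

double-mono-< : ∀ {a b} → a < b → double a < double b
double-mono-< {zero}  {suc b} _         = s≤s z≤n
double-mono-< {suc a} {suc b} (s≤s a<b) = s≤s (s≤s (double-mono-< a<b))

double-cancel-< : ∀ a b → double a < double b → a < b
double-cancel-< zero    (suc b) _               = s≤s z≤n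
double-cancel-< (suc a) (suc b) (s≤s (s≤s a<b)) = s≤s (double-cancel-< a b a<b)

interleaveZeroColumns : InfMatrix → InfMatrix
interleaveZeroColumns M n y = if even y then M n ⌊ y /2⌋ else 0P

evenColumns : InfMatrix → InfMatrix
evenColumns M n c = M n (double c)

evenColumns-TP : ∀ M → TotallyPositive M → TotallyPositive (evenColumns M)
evenColumns-TP M tp r I J sI sJ = tp r I (double ∘ J) sI (λ a b a<b → double-mono-< (sJ a b a<b))

interleaveZeroColumns-TP : ∀ M → TotallyPositive M → TotallyPositive (interleaveZeroColumns M)
interleaveZeroColumns-TP M tp r I J sI sJ with FinP.any? (λ b → BoolP._≟_ (even (J b)) false)
... | yes (b , odd-Jb) = Nonneg-≈0 (det-zeroColumn r _ b zeroColumn)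
  where
  zeroColumn : ∀ a → interleaveZeroColumns M (I a) (J b) ≈ 0P
  zeroColumn a rewrite odd-Jb = ≈-refl
... | no noOdd = Nonneg-resp-≈ (det-cong r sameEntries) (tp r I (⌊_/2⌋ ∘ J) sI halves-increasing)
  where
  allEven : ∀ b → even (J b) ≡ true
  allEven b with even (J b) in eq
  ... | true  = refl
  ... | false = ⊥-elim (noOdd (b , eq))
  halves-increasing : StrictlyIncreasing (⌊_/2⌋ ∘ J)
  halves-increasing a b a<b = double-cancel-< _ _
    (subst₂ _<_ (sym (double-⌊/2⌋ (J a) (allEven a))) (sym (double-⌊/2⌋ (J b) (allEven b))) (sJ a b a<b))
  sameEntries : ∀ a b → M (I a) ⌊ J b /2⌋ ≈ interleaveZeroColumns M (I a) (J b)
  sameEntries a b rewrite allEven b = ≈-refl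

addNeighbourColumns-targeted : ∀ targeted σ x M n y → targeted y ≡ true →
  addNeighbourColumns targeted σ x M n y ≡ M n y +P x y *P M n (σ y)
addNeighbourColumns-targeted targeted σ x M n y e rewrite e = refl

addNeighbourColumns-untargeted : ∀ targeted σ x M n y → targeted y ≡ false →
  addNeighbourColumns targeted σ x M n y ≡ M n y
addNeighbourColumns-untargeted targeted σ x M n y e rewrite e = refl

scaleColumns-targeted : ∀ targeted w M n y → targeted y ≡ true →
  scaleColumns targeted w M n y ≡ w y *P M n y
scaleColumns-targeted targeted w M n y e rewrite e = refl

scaleColumns-untargeted : ∀ targeted w M n y → targeted y ≡ false →
  scaleColumns targeted w M n y ≡ M n y
scaleColumns-untargeted targeted w M n y e rewrite e = refl

odd-double : ∀ c → odd (double c) ≡ false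
odd-double c = cong not (even-double c)

odd-suc-double : ∀ c → odd (suc (double c)) ≡ true
odd-suc-double c = cong not (even-suc-double c)

even⇒¬even-suc : ∀ y → even y ≡ true → even (suc y) ≡ false
even⇒¬even-suc y e = trans (even-suc y) (cong not e)

odd⇒¬odd-suc : ∀ y → odd y ≡ true → odd (suc y) ≡ false
odd⇒¬odd-suc y e with even y | even-suc y
... | false | e′ = cong not e′
... | true  | _  with e
...   | ()

addNextTwoColumns : (ℕ → Poly) → (ℕ → Poly) → InfMatrix → InfMatrix
addNextTwoColumns e₁ e₂ M n c = M n c +P e₁ c *P M n (suc c) +P e₂ c *P M n (suc (suc c))

addNextTwoColumns-cong : ∀ {e₁ e₁′ e₂ e₂′} → (∀ c → e₁ c ≈ e₁′ c) → (∀ c → e₂ c ≈ e₂′ c) →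
  ∀ M n c → addNextTwoColumns e₁ e₂ M n c ≈ addNextTwoColumns e₁′ e₂′ M n c
addNextTwoColumns-cong e₁≈ e₂≈ M n c =
  +-cong (+-congˡ (M n c) (*-congʳ (M n (suc c)) (e₁≈ c))) (*-congʳ (M n (suc (suc c))) (e₂≈ c))

-- The banded column operation is realised on M with zero columns interleaved: column c of M sits
-- at 2c, and five elementary operations between neighbouring columns (the planar network with
-- weights α β w γ δ) carry column 2c to column c of the result.
module NextTwoColumns (α β w γ δ : ℕ → Poly) (M : InfMatrix) where
  E₀ E₁ E₂ E₃ E₄ E₅ : InfMatrix
  E₀ = interleaveZeroColumns M
  E₁ = addNeighbourColumns odd  suc (α ∘ ⌊_/2⌋) E₀
  E₂ = addNeighbourColumns even suc (β ∘ ⌊_/2⌋) E₁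
  E₃ = scaleColumns        odd      (w ∘ ⌊_/2⌋) E₂
  E₄ = addNeighbourColumns odd  suc (γ ∘ ⌊_/2⌋) E₃
  E₅ = addNeighbourColumns even suc (δ ∘ ⌊_/2⌋) E₄

  E₀-even : ∀ n c → E₀ n (double c) ≡ M n c
  E₀-even n c rewrite even-double c | ⌊double/2⌋ c = refl

  E₀-odd : ∀ n c → E₀ n (suc (double c)) ≡ 0P
  E₀-odd n c rewrite even-suc-double c = refl

  E₁-even : ∀ n c → E₁ n (double c) ≡ M n c
  E₁-even n c =
    trans (addNeighbourColumns-untargeted odd suc (α ∘ ⌊_/2⌋) E₀ n (double c) (odd-double c)) (E₀-even n c)

  E₁-odd : ∀ n c → E₁ n (suc (double c)) ≡ α c *P M n (suc c)
  E₁-odd n c =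
    trans (addNeighbourColumns-targeted odd suc (α ∘ ⌊_/2⌋) E₀ n (suc (double c)) (odd-suc-double c))
    (trans (cong₂ (λ u v → u +P α v *P E₀ n (double (suc c))) (E₀-odd n c) (⌊suc-double/2⌋ c))
           (cong (α c *P_) (E₀-even n (suc c))))

  E₂-even : ∀ n c → E₂ n (double c) ≡ M n c +P β c *P (α c *P M n (suc c))
  E₂-even n c =
    trans (addNeighbourColumns-targeted even suc (β ∘ ⌊_/2⌋) E₁ n (double c) (even-double c))
    (trans (cong₂ (λ u v → u +P β v *P E₁ n (suc (double c))) (E₁-even n c) (⌊double/2⌋ c))
           (cong (λ v → M n c +P β c *P v) (E₁-odd n c)))

  E₂-odd : ∀ n c → E₂ n (suc (double c)) ≡ α c *P M n (suc c)
  E₂-odd n c =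
    trans (addNeighbourColumns-untargeted even suc (β ∘ ⌊_/2⌋) E₁ n (suc (double c)) (even-suc-double c))
          (E₁-odd n c)

  E₃-even : ∀ n c → E₃ n (double c) ≡ M n c +P β c *P (α c *P M n (suc c))
  E₃-even n c = trans (scaleColumns-untargeted odd (w ∘ ⌊_/2⌋) E₂ n (double c) (odd-double c)) (E₂-even n c)

  E₃-odd : ∀ n c → E₃ n (suc (double c)) ≡ w c *P (α c *P M n (suc c))
  E₃-odd n c =
    trans (scaleColumns-targeted odd (w ∘ ⌊_/2⌋) E₂ n (suc (double c)) (odd-suc-double c))
          (cong₂ (λ u v → w u *P v) (⌊suc-double/2⌋ c) (E₂-odd n c))

  E₄-even : ∀ n c → E₄ n (double c) ≡ M n c +P β c *P (α c *P M n (suc c))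
  E₄-even n c =
    trans (addNeighbourColumns-untargeted odd suc (γ ∘ ⌊_/2⌋) E₃ n (double c) (odd-double c)) (E₃-even n c)

  E₄-odd : ∀ n c → E₄ n (suc (double c)) ≡
           w c *P (α c *P M n (suc c)) +P γ c *P (M n (suc c) +P β (suc c) *P (α (suc c) *P M n (suc (suc c))))
  E₄-odd n c =
    trans (addNeighbourColumns-targeted odd suc (γ ∘ ⌊_/2⌋) E₃ n (suc (double c)) (odd-suc-double c))
          (cong₂ _+P_ (E₃-odd n c) (cong₂ (λ u v → γ u *P v) (⌊suc-double/2⌋ c) (E₃-even n (suc c))))

  E₅-even : ∀ n c → E₅ n (double c) ≡ E₄ n (double c) +P δ c *P E₄ n (suc (double c))
  E₅-even n c =
    trans (addNeighbourColumns-targeted even suc (δ ∘ ⌊_/2⌋) E₄ n (double c) (even-double c))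
          (cong (λ u → E₄ n (double c) +P δ u *P E₄ n (suc (double c))) (⌊double/2⌋ c))

  evenColumns-E₅ : ∀ n c → evenColumns E₅ n c ≈
    addNextTwoColumns (λ c → α c *P β c +P δ c *P (α c *P w c +P γ c))
                      (λ c → δ c *P γ c *P α (suc c) *P β (suc c)) M n c
  evenColumns-E₅ n c rewrite E₅-even n c | E₄-even n c | E₄-odd n c =
    collect (M n c) (M n (suc c)) (M n (suc (suc c))) (α c) (β c) (w c) (γ c) (δ c) (α (suc c)) (β (suc c))
    where
    collect : ∀ m₀ m₁ m₂ a₀ b₀ w₀ g₀ d₀ a₁ b₁ →
      (m₀ +P b₀ *P (a₀ *P m₁)) +P d₀ *P (w₀ *P (a₀ *P m₁) +P g₀ *P (m₁ +P b₁ *P (a₁ *P m₂)))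
      ≈ m₀ +P (a₀ *P b₀ +P d₀ *P (a₀ *P w₀ +P g₀)) *P m₁ +P d₀ *P g₀ *P a₁ *P b₁ *P m₂
    collect = solve-∀ polyRing′

  evenColumns-E₅-TP : AllNonneg α → AllNonneg β → AllNonneg w → AllNonneg γ → AllNonneg δ →
                      TotallyPositive M → TotallyPositive (evenColumns E₅)
  evenColumns-E₅-TP α≥0 β≥0 w≥0 γ≥0 δ≥0 =
    evenColumns-TP E₅
    ∘ addNeighbourColumns-TP even suc (δ ∘ ⌊_/2⌋) (δ≥0 ∘ ⌊_/2⌋) even⇒¬even-suc (λ _ _ → inj₁ refl) E₄
    ∘ addNeighbourColumns-TP odd  suc (γ ∘ ⌊_/2⌋) (γ≥0 ∘ ⌊_/2⌋) odd⇒¬odd-suc  (λ _ _ → inj₁ refl) E₃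
    ∘ scaleColumns-TP        odd      (w ∘ ⌊_/2⌋) (w≥0 ∘ ⌊_/2⌋)                       E₂
    ∘ addNeighbourColumns-TP even suc (β ∘ ⌊_/2⌋) (β≥0 ∘ ⌊_/2⌋) even⇒¬even-suc (λ _ _ → inj₁ refl) E₁
    ∘ addNeighbourColumns-TP odd  suc (α ∘ ⌊_/2⌋) (α≥0 ∘ ⌊_/2⌋) odd⇒¬odd-suc  (λ _ _ → inj₁ refl) E₀
    ∘ interleaveZeroColumns-TP M

addNextTwoColumns-TP : ∀ {e₁ e₂} (α β w γ δ : ℕ → Poly) →
  AllNonneg α → AllNonneg β → AllNonneg w → AllNonneg γ → AllNonneg δ →
  (∀ c → e₁ c ≈ α c *P β c +P δ c *P (α c *P w c +P γ c)) →
  (∀ c → e₂ c ≈ δ c *P γ c *P α (suc c) *P β (suc c)) →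
  ∀ M → TotallyPositive M → TotallyPositive (addNextTwoColumns e₁ e₂ M)
addNextTwoColumns-TP α β w γ δ α≥0 β≥0 w≥0 γ≥0 δ≥0 e₁≈ e₂≈ M =
  TotallyPositive-resp-≈ (λ n c → ≈-trans (evenColumns-E₅ n c)
                                          (addNextTwoColumns-cong (≈-sym ∘ e₁≈) (≈-sym ∘ e₂≈) M n c))
  ∘ evenColumns-E₅-TP α≥0 β≥0 w≥0 γ≥0 δ≥0
  where open NextTwoColumns α β w γ δ M

positiveEven : ℕ → Bool
positiveEven zero    = false
positiveEven (suc y) = even (suc y)

positiveEven⇒¬positiveEven-pred : ∀ y → positiveEven y ≡ true → positiveEven (ℕ.pred y) ≡ false
positiveEven⇒¬positiveEven-pred (suc zero)    ()
positiveEven⇒¬positiveEven-pred (suc (suc y)) e = trans (even-suc y) (cong not e)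

odd⇒¬odd-pred : ∀ y → odd y ≡ true → odd (ℕ.pred y) ≡ false
odd⇒¬odd-pred (suc y) e with even y | even-suc y
... | true  | _  = refl
... | false | e′ with trans (sym (cong not e′)) e
...   | ()

toPrevious : ∀ (targeted : ℕ → Bool) → targeted 0 ≡ false →
             ∀ y → targeted y ≡ true → ℕ.pred y ≡ suc y ⊎ suc (ℕ.pred y) ≡ y
toPrevious targeted not0 zero    e = ⊥-elim (BoolP.not-¬ refl (trans (sym not0) e))
toPrevious targeted not0 (suc y) _ = inj₂ refl

addPreviousTwoColumns : (ℕ → Poly) → (ℕ → Poly) → InfMatrix → InfMatrix
addPreviousTwoColumns e₁ e₂ M n zero          = M n zero
addPreviousTwoColumns e₁ e₂ M n (suc zero)    = M n 1 +P e₁ 1 *P M n 0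
addPreviousTwoColumns e₁ e₂ M n (suc (suc c)) =
  M n (suc (suc c)) +P e₁ (suc (suc c)) *P M n (suc c) +P e₂ (suc (suc c)) *P M n c

addPreviousTwoColumns-cong : ∀ {e₁ e₁′ e₂ e₂′} →
  (∀ c → e₁ c ≈ e₁′ c) → (∀ c → e₂ (suc (suc c)) ≈ e₂′ (suc (suc c))) →
  ∀ M n c → addPreviousTwoColumns e₁ e₂ M n c ≈ addPreviousTwoColumns e₁′ e₂′ M n c
addPreviousTwoColumns-cong e₁≈ e₂≈ M n zero          = ≈-refl
addPreviousTwoColumns-cong e₁≈ e₂≈ M n (suc zero)    = +-congˡ (M n 1) (*-congʳ (M n 0) (e₁≈ 1))
addPreviousTwoColumns-cong e₁≈ e₂≈ M n (suc (suc c)) =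
  +-cong (+-congˡ (M n (suc (suc c))) (*-congʳ (M n (suc c)) (e₁≈ (suc (suc c))))) (*-congʳ (M n c) (e₂≈ c))

-- The mirror image of `NextTwoColumns`: the same planar network, read towards smaller columns.
module PreviousTwoColumns (α β w γ δ : ℕ → Poly) (M : InfMatrix) where
  E₀ E₁ E₂ E₃ E₄ E₅ : InfMatrix
  E₀ = interleaveZeroColumns M
  E₁ = addNeighbourColumns odd          ℕ.pred (α ∘ suc ∘ ⌊_/2⌋) E₀
  E₂ = addNeighbourColumns positiveEven ℕ.pred (β ∘ ⌊_/2⌋)       E₁
  E₃ = scaleColumns        odd                 (w ∘ suc ∘ ⌊_/2⌋) E₂
  E₄ = addNeighbourColumns odd          ℕ.pred (γ ∘ suc ∘ ⌊_/2⌋) E₃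
  E₅ = addNeighbourColumns positiveEven ℕ.pred (δ ∘ ⌊_/2⌋)       E₄

  E₀-even : ∀ n c → E₀ n (double c) ≡ M n c
  E₀-even n c rewrite even-double c | ⌊double/2⌋ c = refl

  E₀-odd : ∀ n c → E₀ n (suc (double c)) ≡ 0P
  E₀-odd n c rewrite even-suc-double c = refl

  E₁-even : ∀ n c → E₁ n (double c) ≡ M n c
  E₁-even n c =
    trans (addNeighbourColumns-untargeted odd ℕ.pred (α ∘ suc ∘ ⌊_/2⌋) E₀ n (double c) (odd-double c))
          (E₀-even n c)

  E₁-odd : ∀ n c → E₁ n (suc (double c)) ≡ α (suc c) *P M n c
  E₁-odd n c =
    trans (addNeighbourColumns-targeted odd ℕ.pred (α ∘ suc ∘ ⌊_/2⌋) E₀ n (suc (double c)) (odd-suc-double c))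
    (trans (cong₂ (λ u v → u +P α (suc v) *P E₀ n (double c)) (E₀-odd n c) (⌊suc-double/2⌋ c))
           (cong (α (suc c) *P_) (E₀-even n c)))

  E₂-even : ∀ n c → E₂ n (double (suc c)) ≡ M n (suc c) +P β (suc c) *P (α (suc c) *P M n c)
  E₂-even n c =
    trans (addNeighbourColumns-targeted positiveEven ℕ.pred (β ∘ ⌊_/2⌋) E₁ n (double (suc c)) (even-double c))
    (trans (cong₂ (λ u v → u +P β v *P E₁ n (suc (double c))) (E₁-even n (suc c)) (⌊double/2⌋ (suc c)))
           (cong (λ v → M n (suc c) +P β (suc c) *P v) (E₁-odd n c)))

  E₂-odd : ∀ n c → E₂ n (suc (double c)) ≡ α (suc c) *P M n c
  E₂-odd n c =
    trans (addNeighbourColumns-untargeted positiveEven ℕ.pred (β ∘ ⌊_/2⌋) E₁ n (suc (double c))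
                                          (even-suc-double c))
          (E₁-odd n c)

  E₃-even : ∀ n c → E₃ n (double c) ≡ E₂ n (double c)
  E₃-even n c = scaleColumns-untargeted odd (w ∘ suc ∘ ⌊_/2⌋) E₂ n (double c) (odd-double c)

  E₃-odd : ∀ n c → E₃ n (suc (double c)) ≡ w (suc c) *P (α (suc c) *P M n c)
  E₃-odd n c =
    trans (scaleColumns-targeted odd (w ∘ suc ∘ ⌊_/2⌋) E₂ n (suc (double c)) (odd-suc-double c))
          (cong₂ (λ u v → w (suc u) *P v) (⌊suc-double/2⌋ c) (E₂-odd n c))

  E₄-even : ∀ n c → E₄ n (double c) ≡ E₂ n (double c)
  E₄-even n c =
    trans (addNeighbourColumns-untargeted odd ℕ.pred (γ ∘ suc ∘ ⌊_/2⌋) E₃ n (double c) (odd-double c))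
          (E₃-even n c)

  E₄-odd : ∀ n c → E₄ n (suc (double c)) ≡ w (suc c) *P (α (suc c) *P M n c) +P γ (suc c) *P E₂ n (double c)
  E₄-odd n c =
    trans (addNeighbourColumns-targeted odd ℕ.pred (γ ∘ suc ∘ ⌊_/2⌋) E₃ n (suc (double c)) (odd-suc-double c))
          (cong₂ _+P_ (E₃-odd n c) (cong₂ (λ u v → γ (suc u) *P v) (⌊suc-double/2⌋ c) (E₃-even n c)))

  E₅-even : ∀ n c → E₅ n (double (suc c)) ≡ E₄ n (double (suc c)) +P δ (suc c) *P E₄ n (suc (double c))
  E₅-even n c =
    trans (addNeighbourColumns-targeted positiveEven ℕ.pred (δ ∘ ⌊_/2⌋) E₄ n (double (suc c)) (even-double c))
          (cong (λ u → E₄ n (double (suc c)) +P δ u *P E₄ n (suc (double c))) (⌊double/2⌋ (suc c)))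

  evenColumns-E₅ : ∀ n c → evenColumns E₅ n c ≈
    addPreviousTwoColumns (λ c → β c *P α c +P δ c *P (w c *P α c +P γ c))
                          (λ c → δ c *P γ c *P β (ℕ.pred c) *P α (ℕ.pred c)) M n c
  evenColumns-E₅ n zero = ≈-refl
  evenColumns-E₅ n (suc zero) rewrite E₅-even n 0 | E₄-even n 1 | E₄-odd n 0 | E₂-even n 0 =
    collect (M n 1) (M n 0) (α 1) (β 1) (w 1) (γ 1) (δ 1)
    where
    collect : ∀ m₁ m₀ a b w g d →
      (m₁ +P b *P (a *P m₀)) +P d *P (w *P (a *P m₀) +P g *P m₀) ≈ m₁ +P (b *P a +P d *P (w *P a +P g)) *P m₀
    collect = solve-∀ polyRing′
  evenColumns-E₅ n (suc (suc c))
    rewrite E₅-even n (suc c) | E₄-even n (suc (suc c)) | E₄-odd n (suc c) | E₂-even n (suc c) | E₂-even n c =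
    collect (M n (suc (suc c))) (M n (suc c)) (M n c)
            (α (suc (suc c))) (β (suc (suc c))) (w (suc (suc c))) (γ (suc (suc c))) (δ (suc (suc c)))
            (α (suc c)) (β (suc c))
    where
    collect : ∀ m₂ m₁ m₀ a b w g d a′ b′ →
      (m₂ +P b *P (a *P m₁)) +P d *P (w *P (a *P m₁) +P g *P (m₁ +P b′ *P (a′ *P m₀)))
      ≈ m₂ +P (b *P a +P d *P (w *P a +P g)) *P m₁ +P d *P g *P b′ *P a′ *P m₀
    collect = solve-∀ polyRing′

  evenColumns-E₅-TP : AllNonneg α → AllNonneg β → AllNonneg w → AllNonneg γ → AllNonneg δ →
                      TotallyPositive M → TotallyPositive (evenColumns E₅)
  evenColumns-E₅-TP α≥0 β≥0 w≥0 γ≥0 δ≥0 =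
    evenColumns-TP E₅
    ∘ addNeighbourColumns-TP positiveEven ℕ.pred (δ ∘ ⌊_/2⌋) (δ≥0 ∘ ⌊_/2⌋)
        positiveEven⇒¬positiveEven-pred (toPrevious positiveEven refl) E₄
    ∘ addNeighbourColumns-TP odd ℕ.pred (γ ∘ suc ∘ ⌊_/2⌋) (γ≥0 ∘ suc ∘ ⌊_/2⌋)
        odd⇒¬odd-pred (toPrevious odd refl) E₃
    ∘ scaleColumns-TP odd (w ∘ suc ∘ ⌊_/2⌋) (w≥0 ∘ suc ∘ ⌊_/2⌋) E₂
    ∘ addNeighbourColumns-TP positiveEven ℕ.pred (β ∘ ⌊_/2⌋) (β≥0 ∘ ⌊_/2⌋)
        positiveEven⇒¬positiveEven-pred (toPrevious positiveEven refl) E₁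
    ∘ addNeighbourColumns-TP odd ℕ.pred (α ∘ suc ∘ ⌊_/2⌋) (α≥0 ∘ suc ∘ ⌊_/2⌋)
        odd⇒¬odd-pred (toPrevious odd refl) E₀
    ∘ interleaveZeroColumns-TP M

addPreviousTwoColumns-TP : ∀ {e₁ e₂} (α β w γ δ : ℕ → Poly) →
  AllNonneg α → AllNonneg β → AllNonneg w → AllNonneg γ → AllNonneg δ →
  (∀ c → e₁ c ≈ β c *P α c +P δ c *P (w c *P α c +P γ c)) →
  (∀ c → e₂ (suc (suc c)) ≈ δ (suc (suc c)) *P γ (suc (suc c)) *P β (suc c) *P α (suc c)) →
  ∀ M → TotallyPositive M → TotallyPositive (addPreviousTwoColumns e₁ e₂ M)
addPreviousTwoColumns-TP α β w γ δ α≥0 β≥0 w≥0 γ≥0 δ≥0 e₁≈ e₂≈ M =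
  TotallyPositive-resp-≈ (λ n c → ≈-trans (evenColumns-E₅ n c)
                                          (addPreviousTwoColumns-cong (≈-sym ∘ e₁≈) (≈-sym ∘ e₂≈) M n c))
  ∘ evenColumns-E₅-TP α≥0 β≥0 w≥0 γ≥0 δ≥0
  where open PreviousTwoColumns α β w γ δ M

-- The array c and its Hankel matrix

truncateRows : ℕ → InfMatrix → InfMatrix
truncateRows N M n k = if n ℕ.≤ᵇ N then M n k else 0P

truncateRows-cong : ∀ N {M M′} → (∀ n k → M n k ≈ M′ n k) →
                    ∀ n k → truncateRows N M n k ≈ truncateRows N M′ n k
truncateRows-cong N e n k with n ℕ.≤ᵇ N
... | true  = e n k
... | false = ≈-refl

truncateRows-addNextTwoColumns : ∀ N e₁ e₂ M n k →
  addNextTwoColumns e₁ e₂ (truncateRows N M) n k ≈ truncateRows N (addNextTwoColumns e₁ e₂ M) n k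
truncateRows-addNextTwoColumns N e₁ e₂ M n k with n ℕ.≤ᵇ N
... | true  = ≈-refl
... | false = +-cong (*-zeroʳ (e₁ k)) (*-zeroʳ (e₂ k))

truncateRows-addPreviousTwoColumns : ∀ N e₁ e₂ M n k →
  addPreviousTwoColumns e₁ e₂ (truncateRows N M) n k ≈ truncateRows N (addPreviousTwoColumns e₁ e₂ M) n k
truncateRows-addPreviousTwoColumns N e₁ e₂ M n zero with n ℕ.≤ᵇ N
... | true  = ≈-refl
... | false = ≈-refl
truncateRows-addPreviousTwoColumns N e₁ e₂ M n (suc zero) with n ℕ.≤ᵇ N
... | true  = ≈-refl
... | false = *-zeroʳ (e₁ 1)
truncateRows-addPreviousTwoColumns N e₁ e₂ M n (suc (suc k)) with n ℕ.≤ᵇ N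
... | true  = ≈-refl
... | false = +-cong (*-zeroʳ (e₁ (suc (suc k)))) (*-zeroʳ (e₂ (suc (suc k))))

_≥ᵇ_ : ℕ → ℕ → Bool
k     ≥ᵇ zero  = true
zero  ≥ᵇ suc i = false
suc k ≥ᵇ suc i = k ≥ᵇ i

≥ᵇ-suc : ∀ k i → k ≥ᵇ i ≡ true → suc k ≥ᵇ i ≡ true
≥ᵇ-suc k       zero    _ = refl
≥ᵇ-suc (suc k) (suc i) e = ≥ᵇ-suc k i e

≥ᵇ-pred : ∀ k i → k ≥ᵇ suc i ≡ true → k ≥ᵇ i ≡ true
≥ᵇ-pred k       zero    _ = refl
≥ᵇ-pred (suc k) (suc i) e = ≥ᵇ-pred k i e

indicator : Bool → Poly
indicator true  = 1P
indicator false = 0P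

Nonneg-indicator : ∀ b → Nonneg (indicator b)
Nonneg-indicator true  = Nonneg-1P
Nonneg-indicator false = Nonneg-0P

1+p+q : Poly
1+p+q = 1P +P pP +P qP

module Array (s : ℕ) where

  C : InfMatrix
  C = c s

  -- tᶜ k is the other one of p, q, so that tᶜ k + t s k = p + q.
  tᶜ : ℕ → Poly
  tᶜ k = if ⌊ k ℕ.≤? s ⌋ then pP else qP

  Nonneg-t : ∀ k → Nonneg (t s k)
  Nonneg-t k with ⌊ k ℕ.≤? s ⌋
  ... | true  = Nonneg-qP
  ... | false = Nonneg-pP

  Nonneg-tᶜ : ∀ k → Nonneg (tᶜ k)
  Nonneg-tᶜ k with ⌊ k ℕ.≤? s ⌋
  ... | true  = Nonneg-pP
  ... | false = Nonneg-qP

  1+tᶜ+t≈1+p+q : ∀ k → 1P +P (tᶜ k +P t s k) ≈ 1+p+q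
  1+tᶜ+t≈1+p+q k with ⌊ k ℕ.≤? s ⌋
  ... | true  = ≈-sym (+-assoc 1P pP qP)
  ... | false = ≈-trans (+-congˡ 1P (+-comm qP pP)) (≈-sym (+-assoc 1P pP qP))

  from : ℕ → ℕ → Poly
  from i k = indicator (k ≥ᵇ i)

  Nonneg-from : ∀ i → AllNonneg (from i)
  Nonneg-from i k = Nonneg-indicator (k ≥ᵇ i)

  δ₀ : ℕ → Poly
  δ₀ zero    = 1P
  δ₀ (suc _) = 0P

  δ₀-fixed : ∀ k x y → δ₀ k ≈ δ₀ k +P x *P δ₀ (suc k) +P y *P δ₀ (suc (suc k))
  δ₀-fixed k x y =
    ≈-sym (≈-trans (+-cong (≈-trans (+-congˡ (δ₀ k) (*-zeroʳ x)) (+-identityʳ (δ₀ k))) (*-zeroʳ y))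
                   (+-identityʳ (δ₀ k)))

  -- padded i is the block matrix diag(Iᵢ, C).
  padded : ℕ → InfMatrix
  padded zero    n       k       = C n k
  padded (suc i) zero    k       = δ₀ k
  padded (suc i) (suc n) zero    = 0P
  padded (suc i) (suc n) (suc k) = padded i n k

  padded-identityBlock : ∀ i n k → n < i → padded i n k ≡ (if n ℕ.≡ᵇ k then 1P else 0P)
  padded-identityBlock (suc i) zero    zero    _         = refl
  padded-identityBlock (suc i) zero    (suc k) _         = refl
  padded-identityBlock (suc i) (suc n) zero    _         = refl
  padded-identityBlock (suc i) (suc n) (suc k) (s≤s n<i) = padded-identityBlock i n k n<i

  -- The tridiagonal production matrix of C, acting from column i on.
  diagonalFrom subdiagonalFrom : ℕ → ℕ → Poly
  diagonalFrom    i k = if k ≥ᵇ i then 1+p+q else 0P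
  subdiagonalFrom i k = if k ≥ᵇ i then t s (suc (k ∸ i)) else 0P

  padded-production : ∀ i n k →
    padded i n k ≈ addNextTwoColumns (diagonalFrom i) (subdiagonalFrom i) (padded (suc i)) n k
  padded-production zero    zero    zero    = δ₀-fixed 0 1+p+q (t s 1)
  padded-production zero    zero    (suc k) = δ₀-fixed (suc k) 1+p+q (t s (suc (suc k)))
  padded-production zero    (suc n) zero    = ≈-refl
  padded-production zero    (suc n) (suc k) = ≈-refl
  padded-production (suc i) zero    k       = δ₀-fixed k (diagonalFrom (suc i) k) (subdiagonalFrom (suc i) k)
  padded-production (suc i) (suc n) zero    = ≈-refl
  padded-production (suc i) (suc n) (suc k) = padded-production i n k

  scaleFrom : ℕ → ℕ → Poly
  scaleFrom i k = if k ≥ᵇ i then tᶜ (suc (k ∸ i)) else 1P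

  Nonneg-scaleFrom : ∀ i → AllNonneg (scaleFrom i)
  Nonneg-scaleFrom i k with k ≥ᵇ i
  ... | true  = Nonneg-tᶜ _
  ... | false = Nonneg-1P

  Nonneg-subdiagonalFrom : ∀ i → AllNonneg (subdiagonalFrom i)
  Nonneg-subdiagonalFrom i k with k ≥ᵇ i
  ... | true  = Nonneg-t _
  ... | false = Nonneg-0P

  diagonalFrom-factors : ∀ i k → diagonalFrom i k ≈
    from i k *P from i k +P 1P *P (from i k *P scaleFrom i k +P subdiagonalFrom i k)
  diagonalFrom-factors i k with k ≥ᵇ i
  ... | true  = ≈-sym (≈-trans (+-cong (*-identityˡ 1P)
                                       (≈-trans (*-identityˡ _) (+-congʳ (t s (suc (k ∸ i))) (*-identityˡ _))))
                               (1+tᶜ+t≈1+p+q (suc (k ∸ i))))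
  ... | false = ≈-sym (*-zeroʳ 1P)

  subdiagonalFrom-factors : ∀ i k →
    subdiagonalFrom i k ≈ 1P *P subdiagonalFrom i k *P from i (suc k) *P from i (suc k)
  subdiagonalFrom-factors i k with k ≥ᵇ i in k≥i
  ... | true rewrite ≥ᵇ-suc k i k≥i = ≈-sym (≈-trans (*-identityʳ _) (≈-trans (*-identityʳ _) (*-identityˡ _)))
  ... | false = ≈-sym (*-congʳ (from i (suc k)) (*-congʳ (from i (suc k)) (*-zeroʳ 1P)))

  truncatedPadded-step : ∀ N i → TotallyPositive (truncateRows N (padded (suc i))) →
                         TotallyPositive (truncateRows N (padded i))
  truncatedPadded-step N i tp =
    TotallyPositive-resp-≈ sameEntries
      (addNextTwoColumns-TP (from i) (from i) (scaleFrom i) (subdiagonalFrom i) (λ _ → 1P)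
         (Nonneg-from i) (Nonneg-from i) (Nonneg-scaleFrom i) (Nonneg-subdiagonalFrom i) (λ _ → Nonneg-1P)
         (diagonalFrom-factors i) (subdiagonalFrom-factors i) (truncateRows N (padded (suc i))) tp)
    where
    sameEntries : ∀ n k →
      addNextTwoColumns (diagonalFrom i) (subdiagonalFrom i) (truncateRows N (padded (suc i))) n k
      ≈ truncateRows N (padded i) n k
    sameEntries n k =
      ≈-trans (truncateRows-addNextTwoColumns N (diagonalFrom i) (subdiagonalFrom i) (padded (suc i)) n k)
              (truncateRows-cong N (λ n k → ≈-sym (padded-production i n k)) n k)

  truncatedPadded-identity : ∀ N → TotallyPositive (truncateRows N (padded (suc N)))
  truncatedPadded-identity N =
    TotallyPositive-resp-≈ sameEntries (diagonal-TP (λ n → indicator (n ℕ.≤ᵇ N)) (λ n → Nonneg-indicator _))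
    where
    sameEntries : ∀ n k → diagonal (λ n → indicator (n ℕ.≤ᵇ N)) n k ≈ truncateRows N (padded (suc N)) n k
    sameEntries n k with n ℕ.≤ᵇ N in n≤N
    ... | true rewrite padded-identityBlock (suc N) n k (s≤s (ℕP.≤ᵇ⇒≤ n N (subst T (sym n≤N) _))) = ≈-refl
    ... | false with n ℕ.≡ᵇ k
    ...   | true  = ≈-refl
    ...   | false = ≈-refl

  -- Rows beyond N are cut off so that the downward induction on i can start from padded (suc N),
  -- which is the identity on rows ≤ N.
  truncatedPadded-TP : ∀ N d i → i ℕ.+ d ≡ suc N → TotallyPositive (truncateRows N (padded i))
  truncatedPadded-TP N zero    i i≡1+N rewrite ℕP.+-identityʳ i | i≡1+N = truncatedPadded-identity N
  truncatedPadded-TP N (suc d) i i+1+d≡1+N =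
    truncatedPadded-step N i (truncatedPadded-TP N d (suc i) (trans (sym (ℕP.+-suc i d)) i+1+d≡1+N))

  truncatedC-TP : ∀ N → TotallyPositive (truncateRows N C)
  truncatedC-TP N = truncatedPadded-TP N (suc N) 0 refl

  tProduct : ℕ → Poly
  tProduct zero    = 1P
  tProduct (suc m) = tProduct m *P t s (suc m)

  Nonneg-tProduct : AllNonneg tProduct
  Nonneg-tProduct zero    = Nonneg-1P
  Nonneg-tProduct (suc m) = Nonneg-* (Nonneg-tProduct m) (Nonneg-t (suc m))

  -- hankelStage 0 = C · diag(tProduct), and each stage multiplies on the right by one more
  -- factor of the transposed production matrix; stage j agrees with the Hankel matrix
  -- C (n + m) 0 in the columns m < j.
  hankelStage : ℕ → InfMatrix
  hankelStage zero    n m       = tProduct m *P C n m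
  hankelStage (suc j) n zero    = C n 0
  hankelStage (suc j) n (suc m) = hankelStage j (suc n) m

  hankelStage-hankel : ∀ j n m → m < j → hankelStage j n m ≡ C (n ℕ.+ m) 0
  hankelStage-hankel (suc j) n zero    _         rewrite ℕP.+-identityʳ n = refl
  hankelStage-hankel (suc j) n (suc m) (s≤s m<j) rewrite ℕP.+-suc n m     = hankelStage-hankel j (suc n) m m<j

  hankelStage-column0 : ∀ j n → hankelStage j n 0 ≈ C n 0
  hankelStage-column0 zero    n = *-identityˡ (C n 0)
  hankelStage-column0 (suc j) n = ≈-refl

  lowerSubdiagonalFrom : ℕ → ℕ → Poly
  lowerSubdiagonalFrom j k = if k ≥ᵇ suc (suc j) then t s (k ∸ suc j) else 0P

  hankelStage-production : ∀ j n m → hankelStage (suc j) n m ≈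
    addPreviousTwoColumns (diagonalFrom (suc j)) (lowerSubdiagonalFrom j) (hankelStage j) n m
  hankelStage-production zero    n zero                = ≈-sym (*-identityˡ (C n 0))
  hankelStage-production zero    n (suc zero)          =
    ≈-trans (*-identityˡ (C (suc n) 0))
    (≈-trans (+-comm (1+p+q *P C n 0) (t s 1 *P C n 1))
             (≈-sym (+-cong (*-congʳ (C n 1) (*-identityˡ (t s 1))) (*-congˡ 1+p+q (*-identityˡ (C n 0))))))
  hankelStage-production zero    n (suc (suc m))       =
    recurrence (tProduct m) (t s (suc m)) (t s (suc (suc m))) 1+p+q (C n m) (C n (suc m)) (C n (suc (suc m)))
    where
    recurrence : ∀ B T₁ T₂ b c₀ c₁ c₂ →
      (B *P T₁) *P (c₀ +P b *P c₁ +P T₂ *P c₂)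
      ≈ ((B *P T₁) *P T₂) *P c₂ +P b *P ((B *P T₁) *P c₁) +P T₁ *P (B *P c₀)
    recurrence = solve-∀ polyRing′
  hankelStage-production (suc j) n zero                = ≈-refl
  hankelStage-production (suc j) n (suc zero)          =
    ≈-sym (≈-trans (+-identityʳ _) (hankelStage-column0 j (suc n)))
  hankelStage-production (suc j) n (suc (suc zero))    =
    ≈-trans (hankelStage-production j (suc n) 1) (≈-sym (+-identityʳ _))
  hankelStage-production (suc j) n (suc (suc (suc m))) = hankelStage-production j (suc n) (suc (suc m))

  lowerScaleFrom : ℕ → ℕ → Poly
  lowerScaleFrom j k = if k ≥ᵇ suc (suc j) then tᶜ (k ∸ suc j) else pP +P qP

  Nonneg-lowerScaleFrom : ∀ j → AllNonneg (lowerScaleFrom j)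
  Nonneg-lowerScaleFrom j k with k ≥ᵇ suc (suc j)
  ... | true  = Nonneg-tᶜ _
  ... | false = Nonneg-+ Nonneg-pP Nonneg-qP

  Nonneg-lowerSubdiagonalFrom : ∀ j → AllNonneg (lowerSubdiagonalFrom j)
  Nonneg-lowerSubdiagonalFrom j k with k ≥ᵇ suc (suc j)
  ... | true  = Nonneg-t _
  ... | false = Nonneg-0P

  diagonalFrom-factorsˡ : ∀ j k → diagonalFrom (suc j) k ≈
    from (suc j) k *P from (suc j) k +P 1P *P (lowerScaleFrom j k *P from (suc j) k +P lowerSubdiagonalFrom j k)
  diagonalFrom-factorsˡ j k with k ≥ᵇ suc j in k≥1+j | k ≥ᵇ suc (suc j) in k≥2+j
  ... | false | false = ≈-sym (≈-trans (*-congˡ 1P (≈-trans (+-identityʳ _) (*-zeroʳ (pP +P qP)))) (*-zeroʳ 1P))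
  ... | true  | true  =
    ≈-sym (≈-trans (+-cong (*-identityˡ 1P)
                           (≈-trans (*-identityˡ _) (+-congʳ (t s (k ∸ suc j)) (*-identityʳ _))))
                   (1+tᶜ+t≈1+p+q (k ∸ suc j)))
  ... | true  | false =
    ≈-sym (≈-trans (+-cong (*-identityˡ 1P)
                           (≈-trans (*-identityˡ _) (≈-trans (+-identityʳ _) (*-identityʳ (pP +P qP)))))
                   (≈-sym (+-assoc 1P pP qP)))
  ... | false | true  with trans (sym k≥1+j) (≥ᵇ-pred k (suc j) k≥2+j)
  ...   | ()

  lowerSubdiagonalFrom-factors : ∀ j k → lowerSubdiagonalFrom j (suc (suc k)) ≈
    1P *P lowerSubdiagonalFrom j (suc (suc k)) *P from (suc j) (suc k) *P from (suc j) (suc k)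
  lowerSubdiagonalFrom-factors j k with k ≥ᵇ j
  ... | true  = ≈-sym (≈-trans (*-identityʳ _) (≈-trans (*-identityʳ _) (*-identityˡ _)))
  ... | false = ≈-sym (*-congʳ (from (suc j) (suc k)) (*-congʳ (from (suc j) (suc k)) (*-zeroʳ 1P)))

  truncatedHankelStage-TP : ∀ N j → TotallyPositive (truncateRows N (hankelStage j))
  truncatedHankelStage-TP N zero =
    TotallyPositive-resp-≈ sameEntries
      (scaleColumns-TP (λ _ → true) tProduct Nonneg-tProduct (truncateRows N C) (truncatedC-TP N))
    where
    sameEntries : ∀ n m →
      scaleColumns (λ _ → true) tProduct (truncateRows N C) n m ≈ truncateRows N (hankelStage 0) n m
    sameEntries n m with n ℕ.≤ᵇ N
    ... | true  = ≈-refl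
    ... | false = *-zeroʳ (tProduct m)
  truncatedHankelStage-TP N (suc j) =
    TotallyPositive-resp-≈ sameEntries
      (addPreviousTwoColumns-TP (from (suc j)) (from (suc j)) (lowerScaleFrom j) (lowerSubdiagonalFrom j) (λ _ → 1P)
         (Nonneg-from (suc j)) (Nonneg-from (suc j)) (Nonneg-lowerScaleFrom j) (Nonneg-lowerSubdiagonalFrom j)
         (λ _ → Nonneg-1P) (diagonalFrom-factorsˡ j) (lowerSubdiagonalFrom-factors j)
         (truncateRows N (hankelStage j)) (truncatedHankelStage-TP N j))
    where
    sameEntries : ∀ n k →
      addPreviousTwoColumns (diagonalFrom (suc j)) (lowerSubdiagonalFrom j) (truncateRows N (hankelStage j)) n k
      ≈ truncateRows N (hankelStage (suc j)) n k
    sameEntries n k =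
      ≈-trans (truncateRows-addPreviousTwoColumns N (diagonalFrom (suc j)) (lowerSubdiagonalFrom j)
                                                  (hankelStage j) n k)
              (truncateRows-cong N (λ n k → ≈-sym (hankelStage-production j n k)) n k)

bound : ∀ r → (Fin r → ℕ) → ℕ
bound zero    f = 0
bound (suc r) f = f zero ℕ.⊔ bound r (f ∘ suc)

≤-bound : ∀ r f (a : Fin r) → f a ≤ bound r f
≤-bound (suc r) f zero    = ℕP.m≤m⊔n (f zero) _
≤-bound (suc r) f (suc a) = ℕP.≤-trans (≤-bound r (f ∘ suc) a) (ℕP.m≤n⊔m (f zero) _)

proposition3p4 : ∀ (s : ℕ) → StieltjesMomentSeq (λ n → c s n 0)
proposition3p4 s r I J sI sJ =
  Nonneg⇒NonnegCoeffs (Nonneg-resp-≈ (det-cong r hankelEntries) (truncatedHankelStage-TP N j r I J sI sJ))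
  where
  open Array s
  N = bound r I
  j = suc (bound r J)
  hankelEntries : ∀ a b → truncateRows N (hankelStage j) (I a) (J b) ≈ c s (I a ℕ.+ J b) 0
  hankelEntries a b rewrite T⇒≡true (ℕP.≤⇒≤ᵇ (≤-bound r I a)) =
    ≡⇒≈ (hankelStage-hankel j (I a) (J b) (s≤s (≤-bound r J b)))
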